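{- Let $n\ge 6$ be even. If $n\equiv 0\pmod 4$, there are exactly $n+2$ circulant Latin squares of order $n$ with inner distance $\frac n2-1$ and with $m_{1,1}=1$, and exactly $n+2$ such back-circulant Latin squares. If $n\equiv 2\pmod 4$, there are exactly $n$ of each type.
   Context: A Latin square of order $n$ has entries $m_{i,j}\in[1,n]$ with every row and column containing each symbol exactly once. $\mathrm{dist}(a,b)$ is the minimum of the residues in $[0,n-1]$ of $a-b$ and $b-a$ mod $n$; the inner distance is the minimum $\mathrm{dist}$ over horizontally or vertically adjacent cells. $L$ is circulant if each row is the previous row cyclically shifted one place right ($m_{i+1,j+1}=m_{i,j}$ for $j<n$, $m_{i+1,1}=m_{i,n}$), and back-circulant if each row is the previous row cyclically shifted one place left ($m_{i+1,j}=m_{i,j+1}$ for $j<n$, $m_{i+1,n}=m_{i,1}$). -}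

module Defs where

open import Data.Nat using (ℕ; zero; suc; _+_; _∸_; _≤_; _⊔_; _⊓_; ∣_-_∣)
open import Data.Fin using (Fin; toℕ) renaming (zero to fzero)
open import Data.Sum using (_⊎_)
open import Data.Empty using (⊥)
open import Data.Nat.DivMod using (_/_)
open import Data.Vec using (Vec; lookup)
open import Data.List using (List; length)
open import Data.List.Membership.Propositional using (_∈_)
open import Data.List.Relation.Unary.Unique.Propositional using (Unique)
open import Data.Product using (Σ; _×_; ∃)
open import Relation.Binary.PropositionalEquality using (_≡_)

-- A square array of order n: n rows, each a vector of n symbols.
-- Rows/columns are 0-indexed (Fin n); the symbol s : Fin n stands for
-- the paper's symbol s+1 ∈ [1,n].
Square : ℕ → Set
Square n = Vec (Vec (Fin n) n) n

entry : ∀ {n} → Square n → Fin n → Fin n → Fin n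
entry L i j = lookup (lookup L i) j

IsLatin : ∀ {n} → Square n → Set
IsLatin {n} L =
  (∀ (i s : Fin n) → Σ (Fin n) λ j → entry L i j ≡ s × (∀ j' → entry L i j' ≡ s → j' ≡ j)) ×
  (∀ (j s : Fin n) → Σ (Fin n) λ i → entry L i j ≡ s × (∀ i' → entry L i' j ≡ s → i' ≡ i))

-- dist(a,b) = min of the residues in [0,n-1] of a-b and b-a mod n.
-- For 0 ≤ a,b < n with d = |a-b|, these residues are d and (n - d) mod n,
-- so the minimum is min d (n - d) (when d = 0 both residues are 0 and
-- min 0 n = 0).
dist : ∀ {n} → Fin n → Fin n → ℕ
dist {n} a b = ∣ toℕ a - toℕ b ∣ ⊓ (n ∸ ∣ toℕ a - toℕ b ∣)

Adjacent : ∀ {n} → Fin n → Fin n → Fin n → Fin n → Set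
Adjacent i j i' j' =
  (i ≡ i' × toℕ j' ≡ suc (toℕ j)) ⊎ (j ≡ j' × toℕ i' ≡ suc (toℕ i))

InnerDistance : ∀ {n} → Square n → ℕ → Set
InnerDistance {n} L d =
  (∀ (i j i' j' : Fin n) → Adjacent i j i' j' → d ≤ dist (entry L i j) (entry L i' j')) ×
  Σ (Fin n) λ i → Σ (Fin n) λ j → Σ (Fin n) λ i' → Σ (Fin n) λ j' →
    Adjacent i j i' j' × dist (entry L i j) (entry L i' j') ≡ d

IsCirculant : ∀ {n} → Square n → Set
IsCirculant {n} L =
  (∀ (i i' j j' : Fin n) → toℕ i' ≡ suc (toℕ i) → toℕ j' ≡ suc (toℕ j) →
     entry L i' j' ≡ entry L i j) ×
  (∀ (i i' j₁ jₙ : Fin n) → toℕ i' ≡ suc (toℕ i) → toℕ j₁ ≡ 0 → toℕ jₙ ≡ n ∸ 1 →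
     entry L i' j₁ ≡ entry L i jₙ)

IsBackCirculant : ∀ {n} → Square n → Set
IsBackCirculant {n} L =
  (∀ (i i' j j' : Fin n) → toℕ i' ≡ suc (toℕ i) → toℕ j' ≡ suc (toℕ j) →
     entry L i' j ≡ entry L i j') ×
  (∀ (i i' j₁ jₙ : Fin n) → toℕ i' ≡ suc (toℕ i) → toℕ j₁ ≡ 0 → toℕ jₙ ≡ n ∸ 1 →
     entry L i' jₙ ≡ entry L i j₁)

-- m_{1,1} = 1 (symbol 0 in our 0-based encoding)
TopLeftIsOne : ∀ {n} → Square n → Set
TopLeftIsOne {zero} L = ⊥
TopLeftIsOne {suc n} L = toℕ (entry L fzero fzero) ≡ 0

HasExactly : (A : Set) → (A → Set) → ℕ → Set
HasExactly A P c =
  Σ (List A) λ xs → Unique xs × length xs ≡ c ×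
    (∀ x → (P x → x ∈ xs) × (x ∈ xs → P x))

GoodCirculant : (n : ℕ) → Square n → Set
GoodCirculant n L = IsLatin L × IsCirculant L × InnerDistance L (n / 2 ∸ 1) × TopLeftIsOne L

GoodBackCirculant : (n : ℕ) → Square n → Set
GoodBackCirculant n L = IsLatin L × IsBackCirculant L × InnerDistance L (n / 2 ∸ 1) × TopLeftIsOne L

{-# OPTIONS --safe #-}
-- A circulant or back-circulant square is determined by its first row R, read
-- cyclically, and any two adjacent cells carry cyclically consecutive entries of R.
-- With n = 2h, the residues at distance at least h − 1 from 0 are h − 1, h and h + 1,
-- so the squares in question are the cyclic arrangements R of ℤₙ with R 0 = 0 whose
-- consecutive entries differ by short (h − 1), mid (h) or long (h + 1) steps, not all
-- mid. Writing R k ≡ h·k + P k (mod n), where P counts long minus short steps, R is a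
-- permutation iff P never repeats a value at an even gap inside a period (odd gaps are
-- handled similarly). If P is periodic, a global maximum of P sits on a mid step, after
-- which P must fall by h − 1 short steps to a second mid step and climb back by h − 1
-- long steps: R is one of the n rotations of this canonical word. Otherwise P n = ± n
-- and all steps are equal; a constant step h ∓ 1 permutes ℤₙ iff h is even, when
-- (h ∓ 1)² ≡ 1 (mod n).
module Submission where

open import Defs
open import Data.Nat as ℕ using (ℕ; zero; suc; z≤n; s≤s; _≤_; _<_; _+_; _*_; _∸_; _⊓_; ∣_-_∣; NonZero)
import Data.Nat.Properties as ℕP
open import Data.Nat.DivMod using (_%_; _/_; _mod_; m≡m%n+[m/n]*n; m%n<n; m%n%n≡m%n; m<n⇒m%n≡m; [m+n]%n≡m%n; [m+kn]%n≡m%n; n%n≡0; %-distribˡ-+; m*n/n≡m)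
open import Data.Nat.Divisibility using (_∣_; divides)
import Data.Nat.Tactic.RingSolver as ℕSolver
open import Data.Integer as ℤ using (ℤ; +_; -[1+_])
  renaming (_≤_ to _≤ᶻ_; _≤?_ to _≤ᶻ?_; suc to sucℤ; _+_ to _+ᶻ_; _-_ to _-ᶻ_; _*_ to _*ᶻ_; -_ to -ᶻ_)
import Data.Integer.Properties as ℤP
open import Data.Integer.DivMod using (a≡a%ℕn+[a/ℕn]*n; n%ℕd<d)
open import Data.Integer.Tactic.RingSolver using (solve-∀)
open import Algebra.Properties.AbelianGroup ℤP.+-0-abelianGroup using () renaming (∙-cancelˡ to +ᶻ-cancelˡ; ∙-cancelʳ to +ᶻ-cancelʳ)
open import Data.Fin as F using (Fin; toℕ; fromℕ<) renaming (zero to fzero; suc to fsuc)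
import Data.Fin.Properties as FP
open import Data.Vec using (tabulate; lookup)
import Data.Vec.Properties as VP
open import Data.List using (List; []; _∷_; map; length; applyUpTo)
open import Data.List.Properties using (length-map; length-applyUpTo)
open import Data.List.Membership.Propositional using (_∈_)
open import Data.List.Membership.Propositional.Properties using (∈-map⁻)
open import Data.List.Relation.Unary.All as All using (All; []; _∷_)
import Data.List.Relation.Unary.All.Properties as All
open import Data.List.Relation.Unary.Any as Any using (Any; here; there)
import Data.List.Relation.Unary.Any.Properties as Any
open import Data.List.Relation.Unary.AllPairs as AllPairs using (AllPairs; []; _∷_)
import Data.List.Relation.Unary.AllPairs.Properties as AllPairs
open import Data.List.Relation.Unary.Unique.Propositional using (Unique)
open import Data.Product using (Σ; _×_; _,_; proj₁; proj₂)
open import Data.Sum using (_⊎_; inj₁; inj₂; [_,_]′)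
open import Data.Empty using (⊥; ⊥-elim)
open import Function using (case_of_; _∘_)
open import Level using (0ℓ)
open import Relation.Binary.Bundles using (Setoid)
import Relation.Binary.Reasoning.Setoid as SetoidReasoning
open import Relation.Binary.Definitions using (Tri; tri<; tri≈; tri>)
open import Relation.Binary.PropositionalEquality
open import Relation.Nullary using (¬_; Dec; yes; no)

r+[1+q]*n≡r+q*n+n : ∀ r q n → r + suc q * n ≡ r + q * n + n
r+[1+q]*n≡r+q*n+n = ℕSolver.solve-∀

periodic⇒≡% : ∀ {X : Set} {n} .{{_ : NonZero n}} (F : ℕ → X) →
              (∀ k → F (k + n) ≡ F k) → ∀ k → F k ≡ F (k % n)
periodic⇒≡% {n = n} F per k = trans (cong F (m≡m%n+[m/n]*n k n)) (go (k % n) (k / n))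
  where
  go : ∀ r q → F (r + q * n) ≡ F r
  go r zero    = cong F (ℕP.+-identityʳ r)
  go r (suc q) = trans (cong F (r+[1+q]*n≡r+q*n+n r q n)) (trans (per (r + q * n)) (go r q))

-- Integers modulo n

module Congruence (m : ℕ) where
  n : ℕ
  n = suc m

  infix 4 _≋_
  data _≋_ (a b : ℤ) : Set where
    differ-by : (q : ℤ) → a ≡ b +ᶻ q *ᶻ + n → a ≋ b

  ≡⇒≋ : ∀ {a b} → a ≡ b → a ≋ b
  ≡⇒≋ {a} refl = differ-by (+ 0) (sym (trans (cong (a +ᶻ_) (ℤP.*-zeroˡ (+ n))) (ℤP.+-identityʳ a)))

  ≋-refl : ∀ a → a ≋ a
  ≋-refl a = ≡⇒≋ refl

  ≋-sym : ∀ {a b} → a ≋ b → b ≋ a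
  ≋-sym {a} {b} (differ-by q e) = differ-by (-ᶻ q) (trans (lemma b q (+ n)) (cong (λ z → z +ᶻ (-ᶻ q) *ᶻ + n) (sym e)))
    where
    lemma : ∀ b q N → b ≡ b +ᶻ q *ᶻ N +ᶻ (-ᶻ q) *ᶻ N
    lemma = solve-∀

  ≋-trans : ∀ {a b c} → a ≋ b → b ≋ c → a ≋ c
  ≋-trans {c = c} (differ-by q e) (differ-by q' e') =
    differ-by (q' +ᶻ q) (trans e (trans (cong (λ z → z +ᶻ q *ᶻ + n) e') (lemma c q q' (+ n))))
    where
    lemma : ∀ c q q' N → c +ᶻ q' *ᶻ N +ᶻ q *ᶻ N ≡ c +ᶻ (q' +ᶻ q) *ᶻ N
    lemma = solve-∀

  ≋-+ : ∀ {a b c d} → a ≋ b → c ≋ d → a +ᶻ c ≋ b +ᶻ d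
  ≋-+ {b = b} {d = d} (differ-by q e) (differ-by q' e') =
    differ-by (q +ᶻ q') (trans (cong₂ _+ᶻ_ e e') (lemma b d q q' (+ n)))
    where
    lemma : ∀ b d q q' N → b +ᶻ q *ᶻ N +ᶻ (d +ᶻ q' *ᶻ N) ≡ b +ᶻ d +ᶻ (q +ᶻ q') *ᶻ N
    lemma = solve-∀

  ≋-neg : ∀ {a b} → a ≋ b → -ᶻ a ≋ -ᶻ b
  ≋-neg {b = b} (differ-by q e) = differ-by (-ᶻ q) (trans (cong -ᶻ_ e) (lemma b q (+ n)))
    where
    lemma : ∀ b q N → -ᶻ (b +ᶻ q *ᶻ N) ≡ -ᶻ b +ᶻ (-ᶻ q) *ᶻ N
    lemma = solve-∀

  ≋-cancelʳ : ∀ {a b} c → a +ᶻ c ≋ b +ᶻ c → a ≋ b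
  ≋-cancelʳ {a} {b} c (differ-by q e) = differ-by q (+ᶻ-cancelʳ c a _ (trans e (lemma b c q (+ n))))
    where
    lemma : ∀ b c q N → b +ᶻ c +ᶻ q *ᶻ N ≡ b +ᶻ q *ᶻ N +ᶻ c
    lemma = solve-∀

  n≋0 : + n ≋ + 0
  n≋0 = differ-by (+ 1) (sym (ℤP.*-identityˡ (+ n)))

  ∸≋- : ∀ b → b ≤ n → + (n ∸ b) ≋ -ᶻ + b
  ∸≋- b b≤n = differ-by (+ 1) (trans (lemma (+ (n ∸ b)) (+ b))
                (cong (λ z → -ᶻ + b +ᶻ + 1 *ᶻ z) (trans (sym (ℤP.pos-+ (n ∸ b) b)) (cong +_ (ℕP.m∸n+n≡m b≤n)))))
    where
    lemma : ∀ x b → x ≡ -ᶻ b +ᶻ + 1 *ᶻ (x +ᶻ b)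
    lemma = solve-∀

  %ℕ≋ : ∀ z → + (z ℤ.%ℕ n) ≋ z
  %ℕ≋ z = ≋-sym (differ-by (z ℤ./ℕ n) (a≡a%ℕn+[a/ℕn]*n z n))

  %≋ : ∀ x → + (x % n) ≋ + x
  %≋ x = ≋-sym (differ-by (+ (x / n))
           (trans (cong +_ (m≡m%n+[m/n]*n x n)) (trans (ℤP.pos-+ (x % n) _) (cong (+ (x % n) +ᶻ_) (ℤP.pos-* (x / n) n)))))

  ≋0⇒≡0 : ∀ k → k < n → + k ≋ + 0 → k ≡ 0
  ≋0⇒≡0 k k<n (differ-by (+ zero) e) = ℤP.+-injective e
  ≋0⇒≡0 k k<n (differ-by (+ suc j) e) = ⊥-elim (ℕP.<⇒≱ k<n (ℕP.≤-trans (ℕP.m≤m+n n (j * n)) (ℕP.≤-reflexive n+jn≡k)))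
    where
    n+jn≡k : n + j * n ≡ k
    n+jn≡k = sym (ℤP.+-injective (trans e (sym (ℤP.pos-* (suc j) n))))
  ≋0⇒≡0 k k<n (differ-by -[1+ j ] ())

  ≋-setoid : Setoid 0ℓ 0ℓ
  ≋-setoid = record
    { Carrier = ℤ ; _≈_ = _≋_
    ; isEquivalence = record { refl = ≋-refl _ ; sym = ≋-sym ; trans = ≋-trans } }

  module ≋-Reasoning = SetoidReasoning ≋-setoid

  +≋⇒≡0 : ∀ x d → d < n → + (x + d) ≋ + x → d ≡ 0
  +≋⇒≡0 x d d<n c = ≋0⇒≡0 d d<n (≋-cancelʳ (+ x) (begin
    + d +ᶻ + x  ≡⟨ ℤP.+-comm (+ d) (+ x) ⟩
    + x +ᶻ + d  ≡⟨ ℤP.pos-+ x d ⟨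
    + (x + d)   ≈⟨ c ⟩
    + x         ≡⟨ ℤP.+-identityˡ (+ x) ⟨
    + 0 +ᶻ + x  ∎))
    where open ≋-Reasoning

  ≤-≋⇒≡ : ∀ a b → a ≤ b → b < n → + a ≋ + b → a ≡ b
  ≤-≋⇒≡ a b a≤b b<n c with ℕP.m≤n⇒∃[o]m+o≡n a≤b
  ... | d , refl = sym (trans (cong (a ℕ.+_) (+≋⇒≡0 a d (ℕP.≤-<-trans (ℕP.m≤n+m d a) b<n) (≋-sym c))) (ℕP.+-identityʳ a))

  ≋⇒≡ : ∀ a b → a < n → b < n → + a ≋ + b → a ≡ b
  ≋⇒≡ a b a<n b<n c with ℕP.≤-total a b
  ... | inj₁ a≤b = ≤-≋⇒≡ a b a≤b b<n c
  ... | inj₂ b≤a = sym (≤-≋⇒≡ b a b≤a a<n (≋-sym c))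

  %≡⇒≋ : ∀ a b → a % n ≡ b % n → + a ≋ + b
  %≡⇒≋ a b e = ≋-trans (≋-sym (%≋ a)) (≋-trans (≡⇒≋ (cong +_ e)) (%≋ b))

  ≋⇒%≡ : ∀ a b → + a ≋ + b → a % n ≡ b % n
  ≋⇒%≡ a b c = ≋⇒≡ (a % n) (b % n) (m%n<n a n) (m%n<n b n) (≋-trans (%≋ a) (≋-trans c (≋-sym (%≋ b))))

  %-injective-on-window : ∀ x y → x < y → y < x + n → x % n ≢ y % n
  %-injective-on-window x y x<y y<x+n e with ℕP.m≤n⇒∃[o]m+o≡n (ℕP.<⇒≤ x<y)
  ... | d , refl = ℕP.<-irrefl (sym (trans (cong (x ℕ.+_) d≡0) (ℕP.+-identityʳ x))) x<y
    where
    d≡0 : d ≡ 0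
    d≡0 = +≋⇒≡0 x d (ℕP.+-cancelˡ-< x d n y<x+n) (%≡⇒≋ _ _ (sym e))

  periodic⇒≋% : (F : ℕ → ℤ) → (∀ k → F (k + n) ≋ F k) → ∀ k → F k ≋ F (k % n)
  periodic⇒≋% F per k = ≋-trans (≡⇒≋ (cong F (m≡m%n+[m/n]*n k n))) (go (k % n) (k / n))
    where
    go : ∀ r q → F (r + q * n) ≋ F r
    go r zero    = ≡⇒≋ (cong F (ℕP.+-identityʳ r))
    go r (suc q) = ≋-trans (≡⇒≋ (cong F (r+[1+q]*n≡r+q*n+n r q n))) (≋-trans (per (r + q * n)) (go r q))

-- Squares generated by a cyclic row

injective⇒surjective : ∀ {k} (G : Fin k → Fin k) → (∀ {x y} → G x ≡ G y → x ≡ y) →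
                       ∀ s → Σ (Fin k) λ x → G x ≡ s
injective⇒surjective {suc k} G inj s with FP.any? (λ x → G x F.≟ s)
... | yes found = found
... | no missed = ⊥-elim (ℕP.<-irrefl refl (FP.injective⇒≤ {f = squeeze} squeeze-injective))
  where
  G≢s : ∀ x → s ≢ G x
  G≢s x e = missed (x , sym e)
  squeeze : Fin (suc k) → Fin k
  squeeze x = F.punchOut (G≢s x)
  squeeze-injective : ∀ {x y} → squeeze x ≡ squeeze y → x ≡ y
  squeeze-injective {x} {y} e = inj (FP.punchOut-injective (G≢s x) (G≢s y) e)

sq : ∀ {n} → (Fin n → Fin n → Fin n) → Square n
sq f = tabulate (λ i → tabulate (f i))

entry-sq : ∀ {n} (f : Fin n → Fin n → Fin n) i j → entry (sq f) i j ≡ f i j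
entry-sq f i j = trans (cong (λ v → lookup v j) (VP.lookup∘tabulate (λ i → tabulate (f i)) i)) (VP.lookup∘tabulate (f i) j)

sq-entry : ∀ {n} (L : Square n) → sq (entry L) ≡ L
sq-entry L = trans (VP.tabulate-cong (λ i → VP.tabulate∘lookup (lookup L i))) (VP.tabulate∘lookup L)

-- Order n = m + 2 and target inner distance d.
module Rows (m d : ℕ) where
  open Congruence (suc m) public

  last : ℕ
  last = suc m

  distℕ : ℕ → ℕ → ℕ
  distℕ a b = ∣ a - b ∣ ⊓ (n ∸ ∣ a - b ∣)

  distℕ-comm : ∀ a b → distℕ a b ≡ distℕ b a
  distℕ-comm a b = cong (λ z → z ⊓ (n ∸ z)) (ℕP.∣-∣-comm a b)

  toℕ-mod : ∀ x → toℕ (x mod n) ≡ x % n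
  toℕ-mod x = FP.toℕ-fromℕ< (m%n<n x n)

  toℕ-mod-< : ∀ x → x < n → toℕ (x mod n) ≡ x
  toℕ-mod-< x x<n = trans (toℕ-mod x) (m<n⇒m%n≡m x<n)

  mod-toℕ : ∀ (x : Fin n) → toℕ x mod n ≡ x
  mod-toℕ x = FP.toℕ-injective (toℕ-mod-< (toℕ x) (FP.toℕ<n x))

  ≋⇒mod≡ : ∀ a b → + a ≋ + b → a mod n ≡ b mod n
  ≋⇒mod≡ a b c = FP.toℕ-injective (trans (toℕ-mod a) (trans (≋⇒%≡ a b c) (sym (toℕ-mod b))))

  record Row (R : ℕ → ℕ) : Set where
    field
      periodic  : ∀ k → R (k + n) ≡ R k
      bounded   : ∀ k → R k < n
      starts-0  : R 0 ≡ 0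
      injective : ∀ x y → x < n → y < n → R x ≡ R y → x ≡ y
      spread    : ∀ k → d ≤ distℕ (R k) (R (suc k))

    ≡% : ∀ k → R k ≡ R (k % n)
    ≡% = periodic⇒≡% R periodic

    resp-≋ : ∀ a b → + a ≋ + b → R a ≡ R b
    resp-≋ a b c = trans (≡% a) (trans (cong R (≋⇒%≡ a b c)) (sym (≡% b)))

    injective-≋ : ∀ a b → R a ≡ R b → + a ≋ + b
    injective-≋ a b e = %≡⇒≋ a b (injective _ _ (m%n<n a n) (m%n<n b n) (trans (sym (≡% a)) (trans e (≡% b))))

    toℕ-R-mod : ∀ a → toℕ (R a mod n) ≡ R a
    toℕ-R-mod a = toℕ-mod-< (R a) (bounded a)

    surjective : ∀ (s : Fin n) → Σ ℕ λ x → x < n × R x ≡ toℕ s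
    surjective s with injective⇒surjective G G-injective s
      where
      G : Fin n → Fin n
      G x = fromℕ< (bounded (toℕ x))
      G-injective : ∀ {x y} → G x ≡ G y → x ≡ y
      G-injective {x} {y} e = FP.toℕ-injective (injective _ _ (FP.toℕ<n x) (FP.toℕ<n y)
        (trans (sym (FP.toℕ-fromℕ< (bounded (toℕ x)))) (trans (cong toℕ e) (FP.toℕ-fromℕ< (bounded (toℕ y))))))
    ... | x , e = toℕ x , FP.toℕ<n x , trans (sym (FP.toℕ-fromℕ< (bounded (toℕ x)))) (cong toℕ e)

  Attains : (ℕ → ℕ) → Set
  Attains R = Σ ℕ λ k → suc k < n × distℕ (R k) (R (suc k)) ≡ d

  OccursOnce : (Fin n → Fin n) → Fin n → Set
  OccursOnce G s = Σ (Fin n) λ y → G y ≡ s × (∀ y' → G y' ≡ s → y' ≡ y)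

  BijectiveMod : (Fin n → ℕ) → Set
  BijectiveMod idx = ∀ x → x < n → Σ (Fin n) λ y → (+ idx y ≋ + x) × (∀ y' → + idx y' ≋ + x → y' ≡ y)

  module _ {R : ℕ → ℕ} (row : Row R) where
    open Row row

    occursOnce : ∀ idx → BijectiveMod idx → ∀ s → OccursOnce (λ y → R (idx y) mod n) s
    occursOnce idx bij s with surjective s
    ... | x , x<n , Rx≡s with bij x x<n
    ...   | y , idx-y≋x , unique = y , hit , λ y' e → unique y' (injective-≋ (idx y') x (R≡ y' e))
      where
      hit : R (idx y) mod n ≡ s
      hit = FP.toℕ-injective (trans (toℕ-R-mod (idx y)) (trans (resp-≋ (idx y) x idx-y≋x) Rx≡s))
      R≡ : ∀ y' → R (idx y') mod n ≡ s → R (idx y') ≡ R x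
      R≡ y' e = trans (sym (toℕ-R-mod (idx y'))) (trans (cong toℕ e) (sym Rx≡s))

  -- The square built from a row R holds R (idx i j) in cell (i , j).
  record Indexing (idx : Fin n → Fin n → ℕ) : Set where
    field
      rows      : ∀ i → BijectiveMod (idx i)
      columns   : ∀ j → BijectiveMod (λ i → idx i j)
      adjacent  : ∀ i j i' j' → Adjacent i j i' j' → idx i' j' ≡ suc (idx i j) ⊎ idx i j ≡ suc (idx i' j')
      first-row : ∀ j → + idx fzero j ≋ + toℕ j
      wraps     : Σ (Fin n) λ i → Σ (Fin n) λ j → Σ (Fin n) λ i' → Σ (Fin n) λ j' → Adjacent i j i' j' ×
                  ((+ idx i j ≋ + last × + idx i' j' ≋ + n) ⊎ (+ idx i j ≋ + n × + idx i' j' ≋ + last))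

  last≋ : ∀ k → k % n ≡ last → + last ≋ + k
  last≋ k k%n≡last = ≋-trans (≡⇒≋ (cong +_ (sym k%n≡last))) (%≋ k)

  n≋suc : ∀ k → k % n ≡ last → + n ≋ + suc k
  n≋suc k k%n≡last = ≋-trans (≡⇒≋ (ℤP.pos-+ 1 last)) (≋-trans (≋-+ (≋-refl (+ 1)) (last≋ k k%n≡last)) (≡⇒≋ (sym (ℤP.pos-+ 1 k))))

  suc-% : ∀ k → suc k % n ≡ suc (k % n) % n
  suc-% k = begin
    suc k % n                ≡⟨ %-distribˡ-+ 1 k n ⟩
    (1 % n + k % n) % n      ≡⟨ cong (λ z → (1 % n + z) % n) (m%n%n≡m%n k n) ⟨
    (1 % n + k % n % n) % n  ≡⟨ %-distribˡ-+ 1 (k % n) n ⟨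
    suc (k % n) % n          ∎
    where open ≡-Reasoning

  mod-+n : ∀ k → (k + n) mod n ≡ k mod n
  mod-+n k = FP.toℕ-injective (trans (toℕ-mod (k + n)) (trans ([m+n]%n≡m%n k n) (sym (toℕ-mod k))))

  module FromRow {idx : Fin n → Fin n → ℕ} (ix : Indexing idx) where
    open Indexing ix

    fromRow : (ℕ → ℕ) → Square n
    fromRow R = sq (λ i j → R (idx i j) mod n)

    firstRow : Square n → ℕ → ℕ
    firstRow L k = toℕ (entry L fzero (k mod n))

    fromRow-cong : ∀ {R R'} → (∀ k → R k ≡ R' k) → fromRow R ≡ fromRow R'
    fromRow-cong e = VP.tabulate-cong (λ i → VP.tabulate-cong (λ j → cong (_mod n) (e (idx i j))))

    module _ {R : ℕ → ℕ} (row : Row R) where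
      open Row row

      entry-fromRow : ∀ i j → entry (fromRow R) i j ≡ R (idx i j) mod n
      entry-fromRow = entry-sq _

      entry-fromRow-≋ : ∀ i j i' j' → + idx i j ≋ + idx i' j' → entry (fromRow R) i j ≡ entry (fromRow R) i' j'
      entry-fromRow-≋ i j i' j' c = trans (entry-fromRow i j) (trans (cong (_mod n) (resp-≋ _ _ c)) (sym (entry-fromRow i' j')))

      dist-fromRow : ∀ i j i' j' → dist (entry (fromRow R) i j) (entry (fromRow R) i' j') ≡ distℕ (R (idx i j)) (R (idx i' j'))
      dist-fromRow i j i' j' = cong₂ distℕ (trans (cong toℕ (entry-fromRow i j)) (toℕ-R-mod (idx i j)))
                                            (trans (cong toℕ (entry-fromRow i' j')) (toℕ-R-mod (idx i' j')))

      fromRow-latin : IsLatin (fromRow R)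
      fromRow-latin = (λ i → along (λ j → entry-fromRow i j) (occursOnce row (idx i) (rows i)))
                    , (λ j → along (λ i → entry-fromRow i j) (occursOnce row (λ i → idx i j) (columns j)))
        where
        along : ∀ {E G : Fin n → Fin n} → (∀ y → E y ≡ G y) → (∀ s → OccursOnce G s) → ∀ s → OccursOnce E s
        along E≡G once s with once s
        ... | y , e , unique = y , trans (E≡G y) e , λ y' e' → unique y' (trans (sym (E≡G y')) e')

      fromRow-spread : ∀ i j i' j' → Adjacent i j i' j' → d ≤ dist (entry (fromRow R) i j) (entry (fromRow R) i' j')
      fromRow-spread i j i' j' adj rewrite dist-fromRow i j i' j' with adjacent i j i' j' adj
      ... | inj₁ e rewrite e = spread (idx i j)
      ... | inj₂ e rewrite e = subst (d ≤_) (distℕ-comm (R (idx i' j')) (R (suc (idx i' j')))) (spread (idx i' j'))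

      first-row-entry : ∀ j → R (idx fzero j) ≡ R (toℕ j)
      first-row-entry j = resp-≋ _ _ (first-row j)

      fromRow-inner : Attains R → InnerDistance (fromRow R) d
      fromRow-inner (k , k+1<n , attained) =
        fromRow-spread , fzero , j , fzero , j' , inj₁ (refl , toℕj'≡1+toℕj) , (begin
          dist (entry (fromRow R) fzero j) (entry (fromRow R) fzero j')  ≡⟨ dist-fromRow fzero j fzero j' ⟩
          distℕ (R (idx fzero j)) (R (idx fzero j'))                     ≡⟨ cong₂ distℕ (first-row-entry j) (first-row-entry j') ⟩
          distℕ (R (toℕ j)) (R (toℕ j'))                                 ≡⟨ cong₂ (λ a b → distℕ (R a) (R b)) (FP.toℕ-fromℕ< _) (FP.toℕ-fromℕ< k+1<n) ⟩
          distℕ (R k) (R (suc k))                                        ≡⟨ attained ⟩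
          d                                                              ∎)
        where
        open ≡-Reasoning
        j j' : Fin n
        j = fromℕ< (ℕP.<-trans (ℕP.n<1+n k) k+1<n)
        j' = fromℕ< k+1<n
        toℕj'≡1+toℕj : toℕ j' ≡ suc (toℕ j)
        toℕj'≡1+toℕj = trans (FP.toℕ-fromℕ< k+1<n) (cong suc (sym (FP.toℕ-fromℕ< _)))

      fromRow-top : TopLeftIsOne (fromRow R)
      fromRow-top = trans (cong toℕ (entry-fromRow fzero fzero)) (trans (toℕ-R-mod _) (trans (first-row-entry fzero) starts-0))

      firstRow-fromRow : ∀ k → firstRow (fromRow R) k ≡ R k
      firstRow-fromRow k = begin
        toℕ (entry (fromRow R) fzero (k mod n))  ≡⟨ cong toℕ (entry-fromRow fzero (k mod n)) ⟩
        toℕ (R (idx fzero (k mod n)) mod n)      ≡⟨ toℕ-R-mod _ ⟩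
        R (idx fzero (k mod n))                  ≡⟨ first-row-entry (k mod n) ⟩
        R (toℕ (k mod n))                        ≡⟨ cong R (toℕ-mod k) ⟩
        R (k % n)                                ≡⟨ ≡% k ⟨
        R k                                      ∎
        where open ≡-Reasoning

    ≡fromRow : ∀ L → (∀ i j → entry L i j ≡ entry L fzero (idx i j mod n)) → L ≡ fromRow (firstRow L)
    ≡fromRow L e = trans (sym (sq-entry L)) (VP.tabulate-cong (λ i → VP.tabulate-cong (λ j → trans (e i j) (sym (mod-toℕ _)))))

    module _ (L : Square n) (latin : IsLatin L) (inner : InnerDistance L d) (top : TopLeftIsOne L)
             (L≡ : L ≡ fromRow (firstRow L)) where
      private
        r : Fin n → Fin n
        r = entry L fzero
        R : ℕ → ℕ
        R = firstRow L

      entry-via-first-row : ∀ i j a → + idx i j ≋ + a → entry L i j ≡ r (a mod n)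
      entry-via-first-row i j a c = begin
        entry L i j                    ≡⟨ cong (λ L' → entry L' i j) L≡ ⟩
        entry (fromRow R) i j          ≡⟨ entry-sq (λ i j → R (idx i j) mod n) i j ⟩
        toℕ (r (idx i j mod n)) mod n  ≡⟨ mod-toℕ _ ⟩
        r (idx i j mod n)              ≡⟨ cong r (≋⇒mod≡ _ _ c) ⟩
        r (a mod n)                    ∎
        where open ≡-Reasoning

      spread-wrap : ∀ k → k % n ≡ last → d ≤ distℕ (R k) (R (suc k))
      spread-wrap k k%n≡last with wraps
      ... | i , j , i' , j' , adj , inj₁ (c , c') =
        subst (d ≤_) (cong₂ (λ a b → distℕ (toℕ a) (toℕ b))
                        (entry-via-first-row i j k (≋-trans c (last≋ k k%n≡last)))
                        (entry-via-first-row i' j' (suc k) (≋-trans c' (n≋suc k k%n≡last))))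
          (proj₁ inner i j i' j' adj)
      ... | i , j , i' , j' , adj , inj₂ (c , c') =
        subst (d ≤_) (trans (cong₂ (λ a b → distℕ (toℕ a) (toℕ b))
                               (entry-via-first-row i j (suc k) (≋-trans c (n≋suc k k%n≡last)))
                               (entry-via-first-row i' j' k (≋-trans c' (last≋ k k%n≡last))))
                            (distℕ-comm (R (suc k)) (R k)))
          (proj₁ inner i j i' j' adj)

      spread-inside : ∀ k → k % n < last → d ≤ distℕ (R k) (R (suc k))
      spread-inside k k%n<last = proj₁ inner fzero (k mod n) fzero (suc k mod n) (inj₁ (refl , next))
        where
        next : toℕ (suc k mod n) ≡ suc (toℕ (k mod n))
        next = begin
          toℕ (suc k mod n)    ≡⟨ toℕ-mod (suc k) ⟩
          suc k % n            ≡⟨ suc-% k ⟩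
          suc (k % n) % n      ≡⟨ m<n⇒m%n≡m (s≤s k%n<last) ⟩
          suc (k % n)          ≡⟨ cong suc (toℕ-mod k) ⟨
          suc (toℕ (k mod n))  ∎
          where open ≡-Reasoning

      row-of-square : Row R
      row-of-square = record
        { periodic  = λ k → cong (λ z → toℕ (r z)) (mod-+n k)
        ; bounded   = λ k → FP.toℕ<n (r (k mod n))
        ; starts-0  = top
        ; injective = injective
        ; spread    = λ k → [ spread-inside k , spread-wrap k ]′ (ℕP.m≤n⇒m<n∨m≡n (ℕP.≤-pred (m%n<n k n)))
        }
        where
        injective : ∀ x y → x < n → y < n → R x ≡ R y → x ≡ y
        injective x y x<n y<n e with proj₁ latin fzero (r (y mod n))
        ... | j , _ , unique = begin
          x              ≡⟨ toℕ-mod-< x x<n ⟨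
          toℕ (x mod n)  ≡⟨ cong toℕ (unique (x mod n) (FP.toℕ-injective e)) ⟩
          toℕ j          ≡⟨ cong toℕ (unique (y mod n) refl) ⟨
          toℕ (y mod n)  ≡⟨ toℕ-mod-< y y<n ⟩
          y              ∎
          where open ≡-Reasoning

    fromRow-injective : ∀ {R R'} → Row R → Row R' → fromRow R ≡ fromRow R' → R ≗ R'
    fromRow-injective row row' e k = trans (sym (firstRow-fromRow row k)) (trans (cong (λ L → firstRow L k) e) (firstRow-fromRow row' k))

    module Count (Good : Square n → Set)
                 (good-fromRow : ∀ {R} → Row R → Attains R → Good (fromRow R))
                 (good⇒row : ∀ L → Good L → Row (firstRow L) × L ≡ fromRow (firstRow L)) where

      unique : ∀ {rows} → All Row rows → AllPairs (λ R R' → ¬ R ≗ R') rows → Unique (map fromRow rows)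
      unique [] [] = []
      unique (row ∷ rows) (distinct ∷ pairs) =
        All.map⁺ (All.zipWith (λ (row' , R≭R') e → R≭R' (fromRow-injective row row' e)) (rows , distinct)) ∷ unique rows pairs

      count : (rows : List (ℕ → ℕ)) → All (λ R → Row R × Attains R) rows → AllPairs (λ R R' → ¬ R ≗ R') rows →
              (∀ R → Row R → Any (R ≗_) rows) → HasExactly (Square n) Good (length rows)
      count rows good distinct complete =
        map fromRow rows , unique (All.map proj₁ good) distinct , length-map fromRow rows , λ L → listed L , good-if-listed L
        where
        listed : ∀ L → Good L → L ∈ map fromRow rows
        listed L gL with good⇒row L gL
        ... | row , L≡ = Any.map⁺ (Any.map (λ R≗ → trans L≡ (fromRow-cong R≗)) (complete (firstRow L) row))
        good-if-listed : ∀ L → L ∈ map fromRow rows → Good L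
        good-if-listed L L∈ with ∈-map⁻ fromRow L∈
        ... | R , R∈ , refl = good-fromRow (proj₁ (All.lookup good R∈)) (proj₂ (All.lookup good R∈))

  ≋⇒≡-Fin : ∀ (y y' : Fin n) → + toℕ y ≋ + toℕ y' → y ≡ y'
  ≋⇒≡-Fin y y' c = FP.toℕ-injective (≋⇒≡ _ _ (FP.toℕ<n y) (FP.toℕ<n y') c)

  solvable⇒bijectiveMod : (idx : Fin n → ℕ) (solve : ℤ → ℤ) →
                          (∀ y x → + idx y ≋ x → + toℕ y ≋ solve x) →
                          (∀ y x → + toℕ y ≋ solve x → + idx y ≋ x) → BijectiveMod idx
  solvable⇒bijectiveMod idx solve to from x _ =
    y , from y (+ x) y≋ , λ y' c → ≋⇒≡-Fin y' y (≋-trans (to y' (+ x) c) (≋-sym y≋))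
    where
    y : Fin n
    y = fromℕ< (n%ℕd<d (solve (+ x)) n)
    y≋ : + toℕ y ≋ solve (+ x)
    y≋ = ≋-trans (≡⇒≋ (cong +_ (FP.toℕ-fromℕ< (n%ℕd<d (solve (+ x)) n)))) (%ℕ≋ (solve (+ x)))

  shift-bijectiveMod : ∀ (c : ℤ) idx → (∀ y → + idx y ≋ + toℕ y +ᶻ c) → BijectiveMod idx
  shift-bijectiveMod c idx idx≋ = solvable⇒bijectiveMod idx (λ x → x -ᶻ c)
    (λ y x e → ≋-trans (≡⇒≋ (lemma₁ (+ toℕ y) c)) (≋-+ (≋-trans (≋-sym (idx≋ y)) e) (≋-refl (-ᶻ c))))
    (λ y x e → ≋-trans (idx≋ y) (≋-trans (≋-+ e (≋-refl c)) (≡⇒≋ (lemma₂ x c))))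
    where
    lemma₁ : ∀ a c → a ≡ a +ᶻ c -ᶻ c
    lemma₁ = solve-∀
    lemma₂ : ∀ x c → x -ᶻ c +ᶻ c ≡ x
    lemma₂ = solve-∀

  reflect-bijectiveMod : ∀ (c : ℤ) idx → (∀ y → + idx y ≋ c -ᶻ + toℕ y) → BijectiveMod idx
  reflect-bijectiveMod c idx idx≋ = solvable⇒bijectiveMod idx (λ x → c -ᶻ x)
    (λ y x e → ≋-trans (≡⇒≋ (lemma₁ c (+ toℕ y))) (≋-+ (≋-refl c) (≋-neg (≋-trans (≋-sym (idx≋ y)) e))))
    (λ y x e → ≋-trans (idx≋ y) (≋-trans (≋-+ (≋-refl c) (≋-neg e)) (≡⇒≋ (lemma₂ c x))))
    where
    lemma₁ : ∀ c a → a ≡ c -ᶻ (c -ᶻ a)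
    lemma₁ = solve-∀
    lemma₂ : ∀ c x → c -ᶻ (c -ᶻ x) ≡ x
    lemma₂ = solve-∀

  +∸≋ : ∀ a b → b ≤ n → + (a + (n ∸ b)) ≋ + a -ᶻ + b
  +∸≋ a b b≤n = ≋-trans (≡⇒≋ (ℤP.pos-+ a (n ∸ b))) (≋-+ (≋-refl (+ a)) (∸≋- b b≤n))

  ∸-suc : ∀ a → a < n → n ∸ a ≡ suc (n ∸ suc a)
  ∸-suc a a<n = ℕP.+-∸-assoc 1 a<n

  circIdx : Fin n → Fin n → ℕ
  circIdx i j = toℕ j + (n ∸ toℕ i)

  circIndexing : Indexing circIdx
  circIndexing = record
    { rows      = λ i → shift-bijectiveMod (-ᶻ + toℕ i) (circIdx i) (λ y → +∸≋ (toℕ y) (toℕ i) (FP.toℕ≤n i))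
    ; columns   = λ j → reflect-bijectiveMod (+ toℕ j) (λ i → circIdx i j) (λ y → +∸≋ (toℕ j) (toℕ y) (FP.toℕ≤n y))
    ; adjacent  = adjacent
    ; first-row = λ j → ≋-trans (≡⇒≋ (ℤP.pos-+ (toℕ j) n)) (≋-trans (≋-+ (≋-refl (+ toℕ j)) n≋0) (≡⇒≋ (ℤP.+-identityʳ _)))
    ; wraps     = fzero , fzero , fsuc fzero , fzero , inj₂ (refl , refl) , inj₂ (≋-refl _ , ≋-refl _)
    }
    where
    adjacent : ∀ i j i' j' → Adjacent i j i' j' → circIdx i' j' ≡ suc (circIdx i j) ⊎ circIdx i j ≡ suc (circIdx i' j')
    adjacent i j i' j' (inj₁ (refl , j'≡1+j)) = inj₁ (cong (_+ (n ∸ toℕ i)) j'≡1+j)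
    adjacent i j i' j' (inj₂ (refl , i'≡1+i)) = inj₂ (begin
      toℕ j + (n ∸ toℕ i)              ≡⟨ cong (toℕ j ℕ.+_) (∸-suc (toℕ i) (FP.toℕ<n i)) ⟩
      toℕ j + suc (n ∸ suc (toℕ i))    ≡⟨ ℕP.+-suc (toℕ j) _ ⟩
      suc (toℕ j + (n ∸ suc (toℕ i)))  ≡⟨ cong (λ z → suc (toℕ j + (n ∸ z))) i'≡1+i ⟨
      suc (circIdx i' j)               ∎)
      where open ≡-Reasoning

  circIdx≋ : ∀ i j → + circIdx i j ≋ + toℕ j -ᶻ + toℕ i
  circIdx≋ i j = +∸≋ (toℕ j) (toℕ i) (FP.toℕ≤n i)

  module Circulant = FromRow circIndexing

  circIdx-diagonal : ∀ (i i' j j' : Fin n) → toℕ i' ≡ suc (toℕ i) → toℕ j' ≡ suc (toℕ j) → + circIdx i' j' ≋ + circIdx i j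
  circIdx-diagonal i i' j j' i'≡1+i j'≡1+j =
    ≋-trans (circIdx≋ i' j') (≋-trans (≡⇒≋ (diagonal i'≡1+i j'≡1+j)) (≋-sym (circIdx≋ i j)))
    where
    diagonal : toℕ i' ≡ suc (toℕ i) → toℕ j' ≡ suc (toℕ j) → + toℕ j' -ᶻ + toℕ i' ≡ + toℕ j -ᶻ + toℕ i
    diagonal i'≡1+i j'≡1+j rewrite i'≡1+i | j'≡1+j = lemma (+ toℕ j) (+ toℕ i)
      where
      lemma : ∀ a b → (+ 1 +ᶻ a) -ᶻ (+ 1 +ᶻ b) ≡ a -ᶻ b
      lemma = solve-∀

  circIdx-wrap : ∀ (i i' j₁ jₙ : Fin n) → toℕ i' ≡ suc (toℕ i) → toℕ j₁ ≡ 0 → toℕ jₙ ≡ last → + circIdx i' j₁ ≋ + circIdx i jₙ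
  circIdx-wrap i i' j₁ jₙ i'≡1+i j₁≡0 jₙ≡last =
    ≋-trans (circIdx≋ i' j₁) (≋-trans (wrap i'≡1+i j₁≡0 jₙ≡last) (≋-sym (circIdx≋ i jₙ)))
    where
    wrap : toℕ i' ≡ suc (toℕ i) → toℕ j₁ ≡ 0 → toℕ jₙ ≡ last → + toℕ j₁ -ᶻ + toℕ i' ≋ + toℕ jₙ -ᶻ + toℕ i
    wrap i'≡1+i j₁≡0 jₙ≡last rewrite i'≡1+i | j₁≡0 | jₙ≡last = ≋-sym (differ-by (+ 1) (lemma (+ last) (+ toℕ i)))
      where
      lemma : ∀ a b → a -ᶻ b ≡ (+ 0 -ᶻ (+ 1 +ᶻ b)) +ᶻ + 1 *ᶻ (+ 1 +ᶻ a)
      lemma = solve-∀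

  circulant-fromRow : ∀ {R} → Row R → IsCirculant (Circulant.fromRow R)
  circulant-fromRow row =
      (λ i i' j j' i'≡1+i j'≡1+j → Circulant.entry-fromRow-≋ row i' j' i j (circIdx-diagonal i i' j j' i'≡1+i j'≡1+j))
    , (λ i i' j₁ jₙ i'≡1+i j₁≡0 jₙ≡last → Circulant.entry-fromRow-≋ row i' j₁ i jₙ (circIdx-wrap i i' j₁ jₙ i'≡1+i j₁≡0 jₙ≡last))

  circulant-≡fromRow : ∀ L → IsCirculant L → L ≡ Circulant.fromRow (Circulant.firstRow L)
  circulant-≡fromRow L (diagonal , wrap) = Circulant.≡fromRow L (λ i j → from-first-row (toℕ i) i refl j)
    where
    r : Fin n → Fin n
    r = entry L fzero
    r-≋ : ∀ a b → + a ≋ + b → r (a mod n) ≡ r (b mod n)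
    r-≋ a b c = cong r (≋⇒mod≡ a b c)
    from-first-row : ∀ k (i : Fin n) → toℕ i ≡ k → ∀ j → entry L i j ≡ r (circIdx i j mod n)
    from-first-row zero i i≡0 j rewrite FP.toℕ-injective {i = i} {j = fzero} i≡0 = sym (cong r (trans (mod-+n (toℕ j)) (mod-toℕ j)))
    from-first-row (suc k) i i≡1+k j = step (toℕ j) refl
      where
      k<n : k < n
      k<n = ℕP.<-trans (ℕP.n<1+n k) (subst (_< n) i≡1+k (FP.toℕ<n i))
      i₀ : Fin n
      i₀ = fromℕ< k<n
      i≡1+i₀ : toℕ i ≡ suc (toℕ i₀)
      i≡1+i₀ = trans i≡1+k (cong suc (sym (FP.toℕ-fromℕ< k<n)))
      above : ∀ j → entry L i₀ j ≡ r (circIdx i₀ j mod n)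
      above = from-first-row k i₀ (FP.toℕ-fromℕ< k<n)
      step : ∀ t → toℕ j ≡ t → entry L i j ≡ r (circIdx i j mod n)
      step zero j≡0 = trans (wrap i₀ i j jₙ i≡1+i₀ j≡0 (FP.toℕ-fromℕ< (ℕP.n<1+n last)))
                            (trans (above jₙ) (r-≋ _ _ (≋-sym (circIdx-wrap i₀ i j jₙ i≡1+i₀ j≡0 (FP.toℕ-fromℕ< (ℕP.n<1+n last))))))
        where
        jₙ : Fin n
        jₙ = fromℕ< (ℕP.n<1+n last)
      step (suc t) j≡1+t = trans (diagonal i₀ i j₀ j i≡1+i₀ j≡1+j₀)
                                 (trans (above j₀) (r-≋ _ _ (≋-sym (circIdx-diagonal i₀ i j₀ j i≡1+i₀ j≡1+j₀))))
        where
        t<n : t < n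
        t<n = ℕP.<-trans (ℕP.n<1+n t) (subst (_< n) j≡1+t (FP.toℕ<n j))
        j₀ : Fin n
        j₀ = fromℕ< t<n
        j≡1+j₀ : toℕ j ≡ suc (toℕ j₀)
        j≡1+j₀ = trans j≡1+t (cong suc (sym (FP.toℕ-fromℕ< t<n)))

  backIdx : Fin n → Fin n → ℕ
  backIdx i j = toℕ i + toℕ j

  backIndexing : Indexing backIdx
  backIndexing = record
    { rows      = λ i → shift-bijectiveMod (+ toℕ i) (backIdx i) (λ y → ≡⇒≋ (trans (ℤP.pos-+ (toℕ i) (toℕ y)) (ℤP.+-comm (+ toℕ i) (+ toℕ y))))
    ; columns   = λ j → shift-bijectiveMod (+ toℕ j) (λ i → backIdx i j) (λ y → ≡⇒≋ (ℤP.pos-+ (toℕ y) (toℕ j)))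
    ; adjacent  = adjacent
    ; first-row = λ j → ≋-refl _
    ; wraps     = fzero , jₙ , fsuc fzero , jₙ , inj₂ (refl , refl) , inj₁ (jₙ≋last , ≡⇒≋ (cong (λ z → + suc z) (FP.toℕ-fromℕ last)))
    }
    where
    jₙ : Fin n
    jₙ = F.fromℕ last
    jₙ≋last : + toℕ jₙ ≋ + last
    jₙ≋last = ≡⇒≋ (cong +_ (FP.toℕ-fromℕ last))
    adjacent : ∀ i j i' j' → Adjacent i j i' j' → backIdx i' j' ≡ suc (backIdx i j) ⊎ backIdx i j ≡ suc (backIdx i' j')
    adjacent i j i' j' (inj₁ (refl , j'≡1+j)) = inj₁ (trans (cong (toℕ i ℕ.+_) j'≡1+j) (ℕP.+-suc (toℕ i) (toℕ j)))
    adjacent i j i' j' (inj₂ (refl , i'≡1+i)) = inj₁ (cong (_+ toℕ j) i'≡1+i)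

  module BackCirculant = FromRow backIndexing

  backIdx-antidiagonal : ∀ (i i' j j' : Fin n) → toℕ i' ≡ suc (toℕ i) → toℕ j' ≡ suc (toℕ j) → backIdx i' j ≡ backIdx i j'
  backIdx-antidiagonal i i' j j' i'≡1+i j'≡1+j =
    trans (cong (_+ toℕ j) i'≡1+i) (trans (sym (ℕP.+-suc (toℕ i) (toℕ j))) (cong (toℕ i ℕ.+_) (sym j'≡1+j)))

  backIdx-wrap : ∀ (i i' j₁ jₙ : Fin n) → toℕ i' ≡ suc (toℕ i) → toℕ j₁ ≡ 0 → toℕ jₙ ≡ last → + backIdx i' jₙ ≋ + backIdx i j₁
  backIdx-wrap i i' j₁ jₙ i'≡1+i j₁≡0 jₙ≡last rewrite i'≡1+i | j₁≡0 | jₙ≡last =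
    ≋-trans (≡⇒≋ (trans (cong +_ (sym (ℕP.+-suc (toℕ i) last))) (ℤP.pos-+ (toℕ i) n)))
            (≋-trans (≋-+ (≋-refl (+ toℕ i)) n≋0) (≡⇒≋ (trans (ℤP.+-identityʳ _) (cong +_ (sym (ℕP.+-identityʳ (toℕ i)))))))

  backCirculant-fromRow : ∀ {R} → Row R → IsBackCirculant (BackCirculant.fromRow R)
  backCirculant-fromRow row =
      (λ i i' j j' i'≡1+i j'≡1+j → BackCirculant.entry-fromRow-≋ row i' j i j' (≡⇒≋ (cong +_ (backIdx-antidiagonal i i' j j' i'≡1+i j'≡1+j))))
    , (λ i i' j₁ jₙ i'≡1+i j₁≡0 jₙ≡last → BackCirculant.entry-fromRow-≋ row i' jₙ i j₁ (backIdx-wrap i i' j₁ jₙ i'≡1+i j₁≡0 jₙ≡last))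

  backCirculant-≡fromRow : ∀ L → IsBackCirculant L → L ≡ BackCirculant.fromRow (BackCirculant.firstRow L)
  backCirculant-≡fromRow L (antidiagonal , wrap) = BackCirculant.≡fromRow L (λ i j → from-first-row (toℕ i) i refl j)
    where
    r : Fin n → Fin n
    r = entry L fzero
    r-≋ : ∀ a b → + a ≋ + b → r (a mod n) ≡ r (b mod n)
    r-≋ a b c = cong r (≋⇒mod≡ a b c)
    from-first-row : ∀ k (i : Fin n) → toℕ i ≡ k → ∀ j → entry L i j ≡ r (backIdx i j mod n)
    from-first-row zero i i≡0 j rewrite FP.toℕ-injective {i = i} {j = fzero} i≡0 = sym (cong r (mod-toℕ j))
    from-first-row (suc k) i i≡1+k j = step (ℕP.m≤n⇒m<n∨m≡n (ℕP.≤-pred (FP.toℕ<n j)))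
      where
      k<n : k < n
      k<n = ℕP.<-trans (ℕP.n<1+n k) (subst (_< n) i≡1+k (FP.toℕ<n i))
      i₀ : Fin n
      i₀ = fromℕ< k<n
      i≡1+i₀ : toℕ i ≡ suc (toℕ i₀)
      i≡1+i₀ = trans i≡1+k (cong suc (sym (FP.toℕ-fromℕ< k<n)))
      above : ∀ j → entry L i₀ j ≡ r (backIdx i₀ j mod n)
      above = from-first-row k i₀ (FP.toℕ-fromℕ< k<n)
      step : toℕ j < last ⊎ toℕ j ≡ last → entry L i j ≡ r (backIdx i j mod n)
      step (inj₁ j<last) = trans (antidiagonal i₀ i j j' i≡1+i₀ j'≡1+j)
                                 (trans (above j') (r-≋ _ _ (≡⇒≋ (cong +_ (sym (backIdx-antidiagonal i₀ i j j' i≡1+i₀ j'≡1+j))))))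
        where
        j' : Fin n
        j' = fromℕ< (s≤s j<last)
        j'≡1+j : toℕ j' ≡ suc (toℕ j)
        j'≡1+j = FP.toℕ-fromℕ< (s≤s j<last)
      step (inj₂ j≡last) = trans (wrap i₀ i fzero j i≡1+i₀ refl j≡last)
                                 (trans (above fzero) (r-≋ _ _ (≋-sym (backIdx-wrap i₀ i fzero j i≡1+i₀ refl j≡last))))

  CirculantGood BackCirculantGood : Square n → Set
  CirculantGood L = IsLatin L × IsCirculant L × InnerDistance L d × TopLeftIsOne L
  BackCirculantGood L = IsLatin L × IsBackCirculant L × InnerDistance L d × TopLeftIsOne L

  circulant-good : ∀ {R} → Row R → Attains R → CirculantGood (Circulant.fromRow R)
  circulant-good row attains =
    Circulant.fromRow-latin row , circulant-fromRow row , Circulant.fromRow-inner row attains , Circulant.fromRow-top row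

  circulant-row : ∀ L → CirculantGood L → Row (Circulant.firstRow L) × L ≡ Circulant.fromRow (Circulant.firstRow L)
  circulant-row L (latin , circulant , inner , top) = Circulant.row-of-square L latin inner top L≡ , L≡
    where
    L≡ : L ≡ Circulant.fromRow (Circulant.firstRow L)
    L≡ = circulant-≡fromRow L circulant

  backCirculant-good : ∀ {R} → Row R → Attains R → BackCirculantGood (BackCirculant.fromRow R)
  backCirculant-good row attains =
    BackCirculant.fromRow-latin row , backCirculant-fromRow row , BackCirculant.fromRow-inner row attains , BackCirculant.fromRow-top row

  backCirculant-row : ∀ L → BackCirculantGood L → Row (BackCirculant.firstRow L) × L ≡ BackCirculant.fromRow (BackCirculant.firstRow L)
  backCirculant-row L (latin , backCirculant , inner , top) = BackCirculant.row-of-square L latin inner top L≡ , L≡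
    where
    L≡ : L ≡ BackCirculant.fromRow (BackCirculant.firstRow L)
    L≡ = backCirculant-≡fromRow L backCirculant

  module CirculantCount = Circulant.Count CirculantGood circulant-good circulant-row
  module BackCirculantCount = BackCirculant.Count BackCirculantGood backCirculant-good backCirculant-row

-- Step words

parity : ∀ d → Σ ℕ λ m → d ≡ m * 2 ⊎ d ≡ suc (m * 2)
parity zero    = 0 , inj₁ refl
parity (suc d) with parity d
... | m , inj₁ e = m , inj₂ (cong suc e)
... | m , inj₂ e = suc m , inj₁ (cong suc e)

data Step : Set where
  short mid long : Step

tilt : Step → ℤ
tilt short = -[1+ 0 ]
tilt mid   = + 0
tilt long  = + 1

Word : Set
Word = ℕ → Step

drift : Word → ℕ → ℤ
drift f zero    = + 0
drift f (suc k) = tilt (f k) +ᶻ drift f k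

suc≰ : ∀ x → ¬ (sucℤ x ≤ᶻ x)
suc≰ x p = ℤP.<-irrefl refl (ℤP.suc[i]≤j⇒i<j p)

tilt+≤suc : ∀ s x → tilt s +ᶻ x ≤ᶻ sucℤ x
tilt+≤suc short x = ℤP.≤-trans (ℤP.i≤j⇒pred[i]≤j ℤP.≤-refl) (ℤP.i≤suc[i] x)
tilt+≤suc mid   x = ℤP.≤-trans (ℤP.≤-reflexive (ℤP.+-identityˡ x)) (ℤP.i≤suc[i] x)
tilt+≤suc long  x = ℤP.≤-refl

≤suc[tilt+] : ∀ s x → x ≤ᶻ sucℤ (tilt s +ᶻ x)
≤suc[tilt+] short x = ℤP.≤-reflexive (sym (ℤP.suc-pred x))
≤suc[tilt+] mid   x = ℤP.≤-trans (ℤP.i≤suc[i] x) (ℤP.suc-mono (ℤP.≤-reflexive (sym (ℤP.+-identityˡ x))))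
≤suc[tilt+] long  x = ℤP.≤-trans (ℤP.i≤suc[i] x) (ℤP.i≤suc[i] (sucℤ x))

drift-suc≤ : ∀ f k → drift f (suc k) ≤ᶻ sucℤ (drift f k)
drift-suc≤ f k = tilt+≤suc (f k) (drift f k)

drift≤suc : ∀ f k → drift f k ≤ᶻ sucℤ (drift f (suc k))
drift≤suc f k = ≤suc[tilt+] (f k) (drift f k)

drift≤ : ∀ f k → drift f k ≤ᶻ + k
drift≤ f zero    = ℤP.≤-refl
drift≤ f (suc k) = ℤP.≤-trans (drift-suc≤ f k) (ℤP.suc-mono (drift≤ f k))

intermediate-up : ∀ f a d p → drift f a ≤ᶻ p → p ≤ᶻ drift f (a + d) →
                  Σ ℕ λ x → x ≤ d × drift f (a + x) ≡ p
intermediate-up f a zero p lo hi = 0 , z≤n , ℤP.≤-antisym (subst (λ z → drift f z ≤ᶻ p) (sym (ℕP.+-identityʳ a)) lo) hi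
intermediate-up f a (suc d) p lo hi with p ≤ᶻ? drift f (a + d)
... | yes p≤ with intermediate-up f a d p lo p≤
...   | x , x≤d , e = x , ℕP.m≤n⇒m≤1+n x≤d , e
intermediate-up f a (suc d) p lo hi | no p≰ = suc d , ℕP.≤-refl , ℤP.≤-antisym (ℤP.≤-trans step (ℤP.i<j⇒suc[i]≤j (ℤP.≰⇒> p≰))) hi
  where
  step : drift f (a + suc d) ≤ᶻ sucℤ (drift f (a + d))
  step = subst (λ z → drift f z ≤ᶻ sucℤ (drift f (a + d))) (sym (ℕP.+-suc a d)) (drift-suc≤ f (a + d))

intermediate-down : ∀ f a d p → drift f (a + d) ≤ᶻ p → p ≤ᶻ drift f a →
                    Σ ℕ λ x → x ≤ d × drift f (a + x) ≡ p
intermediate-down f a zero p lo hi = 0 , z≤n , ℤP.≤-antisym lo (subst (λ z → p ≤ᶻ drift f z) (sym (ℕP.+-identityʳ a)) hi)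
intermediate-down f a (suc d) p lo hi with drift f (a + d) ≤ᶻ? p
... | yes ≤p with intermediate-down f a d p ≤p hi
...   | x , x≤d , e = x , ℕP.m≤n⇒m≤1+n x≤d , e
intermediate-down f a (suc d) p lo hi | no ≰p = suc d , ℕP.≤-refl , ℤP.≤-antisym lo p≤
  where
  step : drift f (a + d) ≤ᶻ sucℤ (drift f (a + suc d))
  step = subst (λ z → drift f (a + d) ≤ᶻ sucℤ (drift f z)) (sym (ℕP.+-suc a d)) (drift≤suc f (a + d))
  p≤ : p ≤ᶻ drift f (a + suc d)
  p≤ = subst₂ _≤ᶻ_ (ℤP.pred-suc p) (ℤP.pred-suc _) (ℤP.pred-mono (ℤP.≤-trans (ℤP.i<j⇒suc[i]≤j (ℤP.≰⇒> ≰p)) step))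

drift-long-run : ∀ f a d → (∀ e → e < d → f (a + e) ≡ long) → drift f (a + d) ≡ + d +ᶻ drift f a
drift-long-run f a zero    _     = trans (cong (drift f) (ℕP.+-identityʳ a)) (sym (ℤP.+-identityˡ _))
drift-long-run f a (suc d) longs = begin
  drift f (a + suc d)                  ≡⟨ cong (drift f) (ℕP.+-suc a d) ⟩
  tilt (f (a + d)) +ᶻ drift f (a + d)  ≡⟨ cong₂ _+ᶻ_ (cong tilt (longs d ℕP.≤-refl)) (drift-long-run f a d (λ e e<d → longs e (ℕP.m≤n⇒m≤1+n e<d))) ⟩
  + 1 +ᶻ (+ d +ᶻ drift f a)            ≡⟨ ℤP.+-assoc (+ 1) (+ d) (drift f a) ⟨
  + suc d +ᶻ drift f a                 ∎
  where open ≡-Reasoning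

drift-short-run : ∀ f a d → (∀ e → e < d → f (a + e) ≡ short) → drift f a ≡ + d +ᶻ drift f (a + d)
drift-short-run f a zero    _      = trans (sym (ℤP.+-identityˡ _)) (cong (λ z → + 0 +ᶻ drift f z) (sym (ℕP.+-identityʳ a)))
drift-short-run f a (suc d) shorts = begin
  drift f a                                         ≡⟨ drift-short-run f a d (λ e e<d → shorts e (ℕP.m≤n⇒m≤1+n e<d)) ⟩
  + d +ᶻ drift f (a + d)                            ≡⟨ lemma (+ d) (drift f (a + d)) ⟩
  + suc d +ᶻ (-[1+ 0 ] +ᶻ drift f (a + d))          ≡⟨ cong (λ s → + suc d +ᶻ (tilt s +ᶻ drift f (a + d))) (shorts d ℕP.≤-refl) ⟨
  + suc d +ᶻ (tilt (f (a + d)) +ᶻ drift f (a + d))  ≡⟨ cong (λ z → + suc d +ᶻ drift f z) (ℕP.+-suc a d) ⟨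
  + suc d +ᶻ drift f (a + suc d)                    ∎
  where
  open ≡-Reasoning
  lemma : ∀ d x → d +ᶻ x ≡ (+ 1 +ᶻ d) +ᶻ (-[1+ 0 ] +ᶻ x)
  lemma = solve-∀

tilt+≤ : ∀ s → s ≢ long → ∀ x → tilt s +ᶻ x ≤ᶻ x
tilt+≤ short _  x = ℤP.i≤j⇒pred[i]≤j ℤP.≤-refl
tilt+≤ mid   _  x = ℤP.≤-reflexive (ℤP.+-identityˡ x)
tilt+≤ long  ≢l x = ⊥-elim (≢l refl)

drift-no-long : ∀ f a d → (∀ e → e < d → f (a + e) ≢ long) → drift f (a + d) ≤ᶻ drift f a
drift-no-long f a zero    _       = ℤP.≤-reflexive (cong (drift f) (ℕP.+-identityʳ a))
drift-no-long f a (suc d) nolongs =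
  ℤP.≤-trans (ℤP.≤-reflexive (cong (drift f) (ℕP.+-suc a d)))
    (ℤP.≤-trans (tilt+≤ (f (a + d)) (nolongs d ℕP.≤-refl) (drift f (a + d)))
      (drift-no-long f a d (λ e e<d → nolongs e (ℕP.m≤n⇒m≤1+n e<d))))

long-if-rising : ∀ s x y → x ≤ᶻ y → sucℤ y ≤ᶻ tilt s +ᶻ x → s ≡ long
long-if-rising long  x y _   _    = refl
long-if-rising short x y x≤y rise = ⊥-elim (ℤP.<-irrefl refl (ℤP.suc[i]≤j⇒i<j (ℤP.≤-trans rise (ℤP.≤-trans (tilt+≤ short (λ ()) x) x≤y))))
long-if-rising mid   x y x≤y rise = ⊥-elim (ℤP.<-irrefl refl (ℤP.suc[i]≤j⇒i<j (ℤP.≤-trans rise (ℤP.≤-trans (tilt+≤ mid (λ ()) x) x≤y))))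

drift≡k⇒long : ∀ f k → drift f k ≡ + k → ∀ i → i < k → f i ≡ long
drift≡k⇒long f (suc k) e i i<1+k =
  [ drift≡k⇒long f k drift≡k i , (λ { refl → fk≡long }) ]′ (ℕP.m≤n⇒m<n∨m≡n (ℕP.≤-pred i<1+k))
  where
  fk≡long : f k ≡ long
  fk≡long = long-if-rising (f k) (drift f k) (+ k) (drift≤ f k) (ℤP.≤-reflexive (sym e))
  drift≡k : drift f k ≡ + k
  drift≡k = +ᶻ-cancelˡ (+ 1) (drift f k) (+ k) (trans (cong (λ s → tilt s +ᶻ drift f k) (sym fk≡long)) e)

mirror : Step → Step
mirror short = long
mirror mid   = mid
mirror long  = short

mirror-involutive : ∀ s → mirror (mirror s) ≡ s
mirror-involutive short = refl
mirror-involutive mid   = refl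
mirror-involutive long  = refl

tilt-mirror : ∀ s → tilt (mirror s) ≡ -ᶻ tilt s
tilt-mirror short = refl
tilt-mirror mid   = refl
tilt-mirror long  = refl

drift-mirror : ∀ f k → drift (λ i → mirror (f i)) k ≡ -ᶻ drift f k
drift-mirror f zero    = refl
drift-mirror f (suc k) = trans (cong₂ _+ᶻ_ (tilt-mirror (f k)) (drift-mirror f k)) (sym (ℤP.neg-distrib-+ (tilt (f k)) (drift f k)))

Periodic : ℕ → Word → Set
Periodic n f = ∀ k → f (k + n) ≡ f k

drift-+period : ∀ {n} f → Periodic n f → ∀ k → drift f (k + n) ≡ drift f k +ᶻ drift f n
drift-+period f per zero    = sym (ℤP.+-identityˡ _)
drift-+period {n} f per (suc k) = trans (cong₂ _+ᶻ_ (cong tilt (per k)) (drift-+period f per k)) (sym (ℤP.+-assoc (tilt (f k)) (drift f k) (drift f n)))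

drift-shift : ∀ f t k → drift (λ i → f (i + t)) k +ᶻ drift f t ≡ drift f (k + t)
drift-shift f t zero    = ℤP.+-identityˡ _
drift-shift f t (suc k) = trans (ℤP.+-assoc (tilt (f (k + t))) _ _) (cong (tilt (f (k + t)) +ᶻ_) (drift-shift f t k))

argmax : ∀ (F : ℕ → ℤ) m → Σ ℕ λ M → M ≤ m × (∀ k → k ≤ m → F k ≤ᶻ F M)
argmax F zero    = 0 , z≤n , λ { zero _ → ℤP.≤-refl }
argmax F (suc m) with argmax F m
... | M , M≤m , max with F (suc m) ≤ᶻ? F M
...   | yes ≤FM = M , ℕP.m≤n⇒m≤1+n M≤m , λ k k≤ → [ (λ k<1+m → max k (ℕP.≤-pred k<1+m)) , (λ { refl → ≤FM }) ]′ (ℕP.m≤n⇒m<n∨m≡n k≤)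
...   | no ≰FM = suc m , ℕP.≤-refl , λ k k≤ →
  [ (λ k<1+m → ℤP.≤-trans (max k (ℕP.≤-pred k<1+m)) (ℤP.<⇒≤ (ℤP.≰⇒> ≰FM))) , (λ { refl → ℤP.≤-refl }) ]′ (ℕP.m≤n⇒m<n∨m≡n k≤)

_≟ₛ_ : (s t : Step) → Dec (s ≡ t)
short ≟ₛ short = yes refl
short ≟ₛ mid   = no λ ()
short ≟ₛ long  = no λ ()
mid   ≟ₛ short = no λ ()
mid   ≟ₛ mid   = yes refl
mid   ≟ₛ long  = no λ ()
long  ≟ₛ short = no λ ()
long  ≟ₛ mid   = no λ ()
long  ≟ₛ long  = yes refl

first-long : ∀ (f : Word) a d → (∀ e → e < d → f (a + e) ≢ long) ⊎
             (Σ ℕ λ e → e < d × f (a + e) ≡ long × (∀ e' → e' < e → f (a + e') ≢ long))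
first-long f a zero = inj₁ λ e ()
first-long f a (suc d) with first-long f a d
... | inj₂ (e , e<d , long-at-e , before) = inj₂ (e , ℕP.m≤n⇒m≤1+n e<d , long-at-e , before)
... | inj₁ none with f (a + d) ≟ₛ long
...   | yes long-at-d = inj₂ (d , ℕP.≤-refl , long-at-d , none)
...   | no ≢long = inj₁ λ e e<1+d → [ none e , (λ { refl → ≢long }) ]′ (ℕP.m≤n⇒m<n∨m≡n (ℕP.≤-pred e<1+d))

module _ (m : ℕ) where
  open Congruence m

  drift-closes : ∀ f → drift f n ≋ + 0 →
                 drift f n ≡ + 0 ⊎ (∀ i → i < n → f i ≡ long) ⊎ (∀ i → i < n → f i ≡ short)
  drift-closes f c with drift f n in e
  ... | + k with ℕP.m≤n⇒m<n∨m≡n (ℤP.drop‿+≤+ (subst (_≤ᶻ + n) e (drift≤ f n)))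
  ...   | inj₁ k<n  = inj₁ (cong +_ (≋0⇒≡0 k k<n c))
  ...   | inj₂ refl = inj₂ (inj₁ (drift≡k⇒long f n e))
  drift-closes f c | -[1+ k ] with ℕP.m≤n⇒m<n∨m≡n (ℤP.drop‿+≤+ (subst (_≤ᶻ + n) mirrored (drift≤ (λ i → mirror (f i)) n)))
    where
    mirrored : drift (λ i → mirror (f i)) n ≡ + suc k
    mirrored = trans (drift-mirror f n) (cong -ᶻ_ e)
  ... | inj₁ 1+k<n = ⊥-elim (ℕP.1+n≢0 (≋0⇒≡0 (suc k) 1+k<n (≋-neg c)))
  ... | inj₂ refl  = inj₂ (inj₂ λ i i<n → trans (sym (mirror-involutive (f i)))
                       (cong mirror (drift≡k⇒long (λ i → mirror (f i)) n (trans (drift-mirror f n) (cong -ᶻ_ e)) i i<n)))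

-- Orders n = 2h with h ≥ 3

module EvenOrder (g : ℕ) where
  h ℓ : ℕ
  h = suc (suc (suc g))
  ℓ = suc (suc g)

  -- The inner distance n / 2 − 1 of the theorem, written so that Rows' notion of a good
  -- square is literally GoodCirculant n.
  d : ℕ
  d = h * 2 / 2 ∸ 1

  open Rows (suc (suc (suc (suc (g * 2))))) d public

  d≡ℓ : d ≡ ℓ
  d≡ℓ = cong (_∸ 1) (m*n/n≡m h 2)

  H : ℤ
  H = + h

  n≡h+h : n ≡ h + h
  n≡h+h = lemma h
    where
    lemma : ∀ h → h * 2 ≡ h + h
    lemma = ℕSolver.solve-∀

  n≡ℓ+1+h : n ≡ ℓ + suc h
  n≡ℓ+1+h = trans n≡h+h (sym (ℕP.+-suc ℓ h))

  n≡2+ℓ+ℓ : n ≡ suc (suc (ℓ + ℓ))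
  n≡2+ℓ+ℓ = trans n≡h+h (cong suc (ℕP.+-suc ℓ ℓ))

  h<n : h < n
  h<n = ℕP.m<m*n h 2 (s≤s (s≤s z≤n))

  len : Step → ℕ
  len short = ℓ
  len mid   = h
  len long  = suc h

  len≡H+tilt : ∀ s → + len s ≡ H +ᶻ tilt s
  len≡H+tilt short = refl
  len≡H+tilt mid   = sym (ℤP.+-identityʳ H)
  len≡H+tilt long  = trans (cong +_ (ℕP.+-comm 1 h)) (ℤP.pos-+ h 1)

  -- Modulo n the linear part h·k is 0 or h according to the parity of k.
  position : Word → ℕ → ℤ
  position f k = H *ᶻ + k +ᶻ drift f k

  position-suc : ∀ f k → position f (suc k) ≡ position f k +ᶻ + len (f k)
  position-suc f k = begin
    H *ᶻ + suc k +ᶻ (tilt (f k) +ᶻ drift f k)   ≡⟨ lemma H (+ k) (drift f k) (tilt (f k)) ⟩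
    H *ᶻ + k +ᶻ drift f k +ᶻ (H +ᶻ tilt (f k))  ≡⟨ cong (position f k +ᶻ_) (len≡H+tilt (f k)) ⟨
    position f k +ᶻ + len (f k)                 ∎
    where
    open ≡-Reasoning
    lemma : ∀ H k p s → H *ᶻ (+ 1 +ᶻ k) +ᶻ (s +ᶻ p) ≡ H *ᶻ k +ᶻ p +ᶻ (H +ᶻ s)
    lemma = solve-∀

  walk : Word → ℕ → ℕ
  walk f zero    = 0
  walk f (suc k) = (walk f k + len (f k)) % n

  walk-cong : ∀ {f f'} → f ≗ f' → walk f ≗ walk f'
  walk-cong same zero    = refl
  walk-cong same (suc k) = cong₂ (λ a s → (a + len s) % n) (walk-cong same k) (same k)

  walk<n : ∀ f k → walk f k < n
  walk<n f zero    = s≤s z≤n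
  walk<n f (suc k) = m%n<n (walk f k + len (f k)) n

  walk≋position : ∀ f k → + walk f k ≋ position f k
  walk≋position f zero    = ≡⇒≋ (sym (cong (_+ᶻ + 0) (ℤP.*-zeroʳ H)))
  walk≋position f (suc k) = begin
    + walk f (suc k)             ≈⟨ %≋ _ ⟩
    + (walk f k + len (f k))     ≡⟨ ℤP.pos-+ (walk f k) (len (f k)) ⟩
    + walk f k +ᶻ + len (f k)    ≈⟨ ≋-+ (walk≋position f k) (≋-refl _) ⟩
    position f k +ᶻ + len (f k)  ≡⟨ position-suc f k ⟨
    position f (suc k)           ∎
    where open ≋-Reasoning

  WindowInjective : Word → Set
  WindowInjective f = ∀ x y → x < y → y < x + n → ¬ position f x ≋ position f y

  module LocalConstraints {f : Word} (injective : WindowInjective f) where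

    no-full-turn : ∀ k → len (f k) + len (f (suc k)) ≢ n
    no-full-turn k e = injective k (suc (suc k)) (s≤s (ℕP.n≤1+n k)) 2+k<k+n (≋-sym (differ-by (+ 1) two-steps))
      where
      2+k<k+n : suc (suc k) < k + n
      2+k<k+n = subst (suc (suc k) <_) (ℕP.+-comm n k) (s≤s (s≤s (s≤s (ℕP.m≤n+m k _))))
      two-steps : position f (suc (suc k)) ≡ position f k +ᶻ + 1 *ᶻ + n
      two-steps = begin
        position f (suc (suc k))                            ≡⟨ position-suc f (suc k) ⟩
        position f (suc k) +ᶻ + len (f (suc k))             ≡⟨ cong (_+ᶻ + len (f (suc k))) (position-suc f k) ⟩
        position f k +ᶻ + len (f k) +ᶻ + len (f (suc k))    ≡⟨ ℤP.+-assoc (position f k) _ _ ⟩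
        position f k +ᶻ (+ len (f k) +ᶻ + len (f (suc k)))  ≡⟨ cong (position f k +ᶻ_) (trans (sym (ℤP.pos-+ (len (f k)) _)) (cong +_ e)) ⟩
        position f k +ᶻ + n                                 ≡⟨ cong (position f k +ᶻ_) (ℤP.*-identityˡ (+ n)) ⟨
        position f k +ᶻ + 1 *ᶻ + n                          ∎
        where open ≡-Reasoning

    no-short-long : ∀ k → f k ≡ short → f (suc k) ≡ long → ⊥
    no-short-long k fk fk' = no-full-turn k (trans (cong₂ _+_ (cong len fk) (cong len fk')) (sym n≡ℓ+1+h))

    no-long-short : ∀ k → f k ≡ long → f (suc k) ≡ short → ⊥
    no-long-short k fk fk' = no-full-turn k (trans (cong₂ _+_ (cong len fk) (cong len fk')) (trans (ℕP.+-comm (suc h) ℓ) (sym n≡ℓ+1+h)))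

    no-mid-mid : ∀ k → f k ≡ mid → f (suc k) ≡ mid → ⊥
    no-mid-mid k fk fk' = no-full-turn k (trans (cong₂ _+_ (cong len fk) (cong len fk')) (sym n≡h+h))

    drift-even-gap : ∀ u m → 0 < m → m * 2 < n → drift f u ≢ drift f (u + m * 2)
    drift-even-gap u m 0<m 2m<n e = injective u (u + m * 2) u<u+2m (ℕP.+-monoʳ-< u 2m<n) (≋-sym (differ-by (+ m) positions))
      where
      u<u+2m : u < u + m * 2
      u<u+2m = subst (_< u + m * 2) (ℕP.+-identityʳ u) (ℕP.+-monoʳ-< u (ℕP.<-≤-trans 0<m (ℕP.m≤m*n m 2)))
      lemma : ∀ H u m p → H *ᶻ (u +ᶻ m *ᶻ + 2) +ᶻ p ≡ H *ᶻ u +ᶻ p +ᶻ m *ᶻ (H +ᶻ H)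
      lemma = solve-∀
      positions : position f (u + m * 2) ≡ position f u +ᶻ + m *ᶻ + n
      positions = begin
        H *ᶻ + (u + m * 2) +ᶻ drift f (u + m * 2)  ≡⟨ cong₂ (λ a b → H *ᶻ a +ᶻ b) (trans (ℤP.pos-+ u _) (cong (+ u +ᶻ_) (ℤP.pos-* m 2))) (sym e) ⟩
        H *ᶻ (+ u +ᶻ + m *ᶻ + 2) +ᶻ drift f u      ≡⟨ lemma H (+ u) (+ m) (drift f u) ⟩
        position f u +ᶻ + m *ᶻ (H +ᶻ H)            ≡⟨ cong (λ z → position f u +ᶻ + m *ᶻ z) (trans (sym (ℤP.pos-+ h h)) (cong +_ (sym n≡h+h))) ⟩
        position f u +ᶻ + m *ᶻ + n                 ∎
        where open ≡-Reasoning

    flat-unique-before : ∀ u c → u < c → suc c < u + n → drift f u ≡ drift f c → drift f c ≡ drift f (suc c) → ⊥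
    flat-unique-before u c u<c 1+c<u+n same flat with ℕP.m≤n⇒∃[o]m+o≡n (ℕP.<⇒≤ u<c)
    ... | δ , refl with parity δ
    ...   | m , inj₁ refl = drift-even-gap u m 0<m 2m<n same
      where
      0<m : 0 < m
      0<m = ℕP.n≢0⇒n>0 λ { refl → ℕP.<-irrefl (sym (ℕP.+-identityʳ u)) u<c }
      2m<n : m * 2 < n
      2m<n = ℕP.+-cancelˡ-< u _ n (ℕP.<-trans (ℕP.n<1+n _) 1+c<u+n)
    ...   | m , inj₂ refl = drift-even-gap u (suc m) (s≤s z≤n) 2m+2<n (trans same (trans flat (cong (drift f) (sym (ℕP.+-suc u (suc (m * 2)))))))
      where
      2m+2<n : suc m * 2 < n
      2m+2<n = ℕP.+-cancelˡ-< u _ n (subst (_< u + n) (sym (ℕP.+-suc u (suc (m * 2)))) 1+c<u+n)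

    flat-unique-after : ∀ c x → suc c < x → x < c + n → drift f c ≡ drift f (suc c) → drift f x ≡ drift f c → ⊥
    flat-unique-after c x 1+c<x x<c+n flat same with ℕP.m≤n⇒∃[o]m+o≡n (ℕP.<⇒≤ 1+c<x)
    ... | δ , refl with parity δ
    ...   | m , inj₁ refl = drift-even-gap (suc c) m 0<m 2m<n (trans (sym flat) (sym same))
      where
      0<m : 0 < m
      0<m = ℕP.n≢0⇒n>0 λ { refl → ℕP.<-irrefl (sym (ℕP.+-identityʳ (suc c))) 1+c<x }
      2m<n : m * 2 < n
      2m<n = ℕP.+-cancelˡ-< (suc c) _ n (ℕP.<-trans x<c+n (ℕP.n<1+n _))
    ...   | m , inj₂ refl = drift-even-gap c (suc m) (s≤s z≤n) 2m+2<n (trans (sym same) (cong (drift f) (shift c m)))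
      where
      shift : ∀ c m → suc c + suc (m * 2) ≡ c + suc m * 2
      shift = ℕSolver.solve-∀
      2m+2<n : suc m * 2 < n
      2m+2<n = ℕP.+-cancelˡ-< c _ n (subst (_< c + n) (shift c m) x<c+n)

  canonical : Word
  canonical zero = mid
  canonical (suc j) with ℕP.<-cmp j ℓ
  ... | tri< _ _ _ = short
  ... | tri≈ _ _ _ = mid
  ... | tri> _ _ _ = long

  canonical-short : ∀ j → j < ℓ → canonical (suc j) ≡ short
  canonical-short j j<ℓ with ℕP.<-cmp j ℓ
  ... | tri< _ _ _   = refl
  ... | tri≈ ¬< _ _  = ⊥-elim (¬< j<ℓ)
  ... | tri> ¬< _ _  = ⊥-elim (¬< j<ℓ)

  canonical-mid : canonical (suc ℓ) ≡ mid
  canonical-mid with ℕP.<-cmp ℓ ℓ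
  ... | tri< _ ≢ _ = ⊥-elim (≢ refl)
  ... | tri≈ _ _ _ = refl
  ... | tri> _ ≢ _ = ⊥-elim (≢ refl)

  canonical-long : ∀ j → ℓ < j → canonical (suc j) ≡ long
  canonical-long j ℓ<j with ℕP.<-cmp j ℓ
  ... | tri< _ _ ¬> = ⊥-elim (¬> ℓ<j)
  ... | tri≈ _ _ ¬> = ⊥-elim (¬> ℓ<j)
  ... | tri> _ _ _  = refl

  Rotation : Word → Set
  Rotation f = Σ ℕ λ t → t < n × (∀ k → f k ≡ canonical ((k + t) % n))

  constant-position : ∀ f s k → (∀ i → i < k → f i ≡ s) → position f k ≡ + (k * len s)
  constant-position f s zero    _       = cong (_+ᶻ + 0) (ℤP.*-zeroʳ H)
  constant-position f s (suc k) const = begin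
    position f (suc k)           ≡⟨ position-suc f k ⟩
    position f k +ᶻ + len (f k)  ≡⟨ cong₂ (λ a b → a +ᶻ + len b) (constant-position f s k (λ i i<k → const i (ℕP.m≤n⇒m≤1+n i<k))) (const k ℕP.≤-refl) ⟩
    + (k * len s) +ᶻ + len s     ≡⟨ ℤP.pos-+ (k * len s) (len s) ⟨
    + (k * len s + len s)        ≡⟨ cong +_ (ℕP.+-comm (k * len s) (len s)) ⟩
    + (suc k * len s)            ∎
    where open ≡-Reasoning

  odd-h-multiple : ∀ s m → s ≢ mid → h ≡ suc (m * 2) → Σ ℕ λ q → h * len s ≡ q * n
  odd-h-multiple short m _   h≡ = m , subst (λ x → x * ℓ ≡ m * (x * 2)) (sym h≡) (trans (cong (suc (m * 2) *_) ℓ≡) (lemma m))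
    where
    ℓ≡ : ℓ ≡ m * 2
    ℓ≡ = ℕP.suc-injective h≡
    lemma : ∀ m → suc (m * 2) * (m * 2) ≡ m * (suc (m * 2) * 2)
    lemma = ℕSolver.solve-∀
  odd-h-multiple mid   m ≢mid _ = ⊥-elim (≢mid refl)
  odd-h-multiple long  m _   h≡ = suc m , subst (λ x → x * suc x ≡ suc m * (x * 2)) (sym h≡) (lemma m)
    where
    lemma : ∀ m → suc (m * 2) * suc (suc (m * 2)) ≡ suc m * (suc (m * 2) * 2)
    lemma = ℕSolver.solve-∀

  realign-offset : ℕ → ℕ
  realign-offset k₀ = (n ∸ k₀ % n) % n

  realign-≋ : ∀ k₀ k → + (k₀ + (k + realign-offset k₀) % n) ≋ + k
  realign-≋ k₀ k = begin
    + (k₀ + (k + t) % n)             ≈⟨ ≡⇒≋ (ℤP.pos-+ k₀ _) ⟩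
    + k₀ +ᶻ + ((k + t) % n)          ≈⟨ ≋-+ (≋-refl (+ k₀)) (%≋ (k + t)) ⟩
    + k₀ +ᶻ + (k + t)                ≈⟨ ≋-+ (≋-refl (+ k₀)) (≡⇒≋ (ℤP.pos-+ k t)) ⟩
    + k₀ +ᶻ (+ k +ᶻ + t)             ≈⟨ ≋-+ (≋-refl (+ k₀)) (≋-+ (≋-refl (+ k)) (%≋ (n ∸ k₀ % n))) ⟩
    + k₀ +ᶻ (+ k +ᶻ + (n ∸ k₀ % n))  ≈⟨ ≋-+ (≋-refl (+ k₀)) (≋-+ (≋-refl (+ k)) (∸≋- (k₀ % n) (ℕP.<⇒≤ (m%n<n k₀ n)))) ⟩
    + k₀ +ᶻ (+ k +ᶻ -ᶻ + (k₀ % n))   ≈⟨ ≋-+ (≋-refl (+ k₀)) (≋-+ (≋-refl (+ k)) (≋-neg (%≋ k₀))) ⟩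
    + k₀ +ᶻ (+ k +ᶻ -ᶻ + k₀)         ≈⟨ ≡⇒≋ (lemma (+ k₀) (+ k)) ⟩
    + k                              ∎
    where
    open ≋-Reasoning
    t : ℕ
    t = realign-offset k₀
    lemma : ∀ a b → a +ᶻ (b +ᶻ -ᶻ a) ≡ b
    lemma = solve-∀

  realign : ∀ {f w : Word} → Periodic n f → ∀ k₀ → (∀ j → j < n → f (k₀ + j) ≡ w j) →
            Σ ℕ λ t → t < n × (∀ k → f k ≡ w ((k + t) % n))
  realign {f} {w} periodic k₀ from-k₀ = realign-offset k₀ , m%n<n (n ∸ k₀ % n) n , λ k → begin
    f k                 ≡⟨ periodic⇒≡% f periodic k ⟩
    f (k % n)           ≡⟨ cong f (≋⇒%≡ _ _ (realign-≋ k₀ k)) ⟨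
    f ((k₀ + j k) % n)  ≡⟨ periodic⇒≡% f periodic (k₀ + j k) ⟨
    f (k₀ + j k)        ≡⟨ from-k₀ (j k) (m%n<n (k + realign-offset k₀) n) ⟩
    w (j k)             ∎
    where
    open ≡-Reasoning
    j : ℕ → ℕ
    j k = (k + realign-offset k₀) % n

  module Classification {f : Word} (periodic : Periodic n f) (injective : WindowInjective f) where
    open LocalConstraints injective

    ≡% : ∀ k → f k ≡ f (k % n)
    ≡% = periodic⇒≡% f periodic

    constant : ∀ s → (∀ i → i < n → f i ≡ s) → ∀ k → f k ≡ s
    constant s const k = trans (≡% k) (const (k % n) (m%n<n k n))

    constant⇒even : ∀ s → s ≢ mid → (∀ i → i < n → f i ≡ s) → 2 ∣ h
    constant⇒even s ≢mid const with parity h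
    ... | m , inj₁ h≡ = divides m h≡
    ... | m , inj₂ h≡ with odd-h-multiple s m ≢mid h≡
    ...   | q , h*len≡ = ⊥-elim (injective 0 h (s≤s z≤n) h<n (≋-sym (differ-by (+ q) (begin
      position f h                ≡⟨ constant-position f s h (λ i i<h → const i (ℕP.<-trans i<h h<n)) ⟩
      + (h * len s)               ≡⟨ cong +_ h*len≡ ⟩
      + (q * n)                   ≡⟨ ℤP.pos-* q n ⟩
      + q *ᶻ + n                  ≡⟨ ℤP.+-identityˡ _ ⟨
      + 0 +ᶻ + q *ᶻ + n           ≡⟨ cong (λ z → z +ᶻ + 0 +ᶻ + q *ᶻ + n) (ℤP.*-zeroʳ H) ⟨
      position f 0 +ᶻ + q *ᶻ + n  ∎))))
      where open ≡-Reasoning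

    module Balanced (balanced : drift f n ≡ + 0) where
      drift-periodic : ∀ k → drift f (k + n) ≡ drift f k
      drift-periodic k = trans (drift-+period f periodic k) (trans (cong (drift f k +ᶻ_) balanced) (ℤP.+-identityʳ _))

      drift-n+ : ∀ k → drift f (n + k) ≡ drift f k
      drift-n+ k = trans (cong (drift f) (ℕP.+-comm n k)) (drift-periodic k)

      global-max : Σ ℕ λ M → ∀ k → drift f k ≤ᶻ drift f M
      global-max with argmax (drift f) last
      ... | M , _ , max = M , λ k → subst (_≤ᶻ drift f M) (sym (periodic⇒≡% (drift f) drift-periodic k)) (max (k % n) (ℕP.≤-pred (m%n<n k n)))

      mid-at-max : ∀ M → (∀ k → drift f k ≤ᶻ drift f M) → Σ ℕ λ k₀ → f k₀ ≡ mid × drift f k₀ ≡ drift f M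
      mid-at-max M max with f (n + M) in step
      ... | mid   = n + M , step , drift-n+ M
      ... | long  = ⊥-elim (suc≰ _ (subst (_≤ᶻ drift f M) rises (max (suc (n + M)))))
        where
        rises : drift f (suc (n + M)) ≡ sucℤ (drift f M)
        rises = trans (cong (λ s → tilt s +ᶻ drift f (n + M)) step) (cong sucℤ (drift-n+ M))
      ... | short with f (last + M) in before
      ...   | mid   = last + M , before , trans (sym (ℤP.+-identityˡ _)) (trans (cong (λ s → tilt s +ᶻ drift f (last + M)) (sym before)) (drift-n+ M))
      ...   | long  = ⊥-elim (no-long-short (last + M) before step)
      ...   | short = ⊥-elim (suc≰ _ (subst (_≤ᶻ drift f M) higher (max (last + M))))
        where
        higher : drift f (last + M) ≡ sucℤ (drift f M)
        higher = trans (sym (ℤP.suc-pred _)) (cong sucℤ (trans (cong (λ s → tilt s +ᶻ drift f (last + M)) (sym before)) (drift-n+ M)))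


      -- From a mid step at a global maximum of the drift, the drift falls by shorts to a
      -- second mid step (the valley) and climbs back by longs, both runs of length ℓ.
      module FromPeak (k₀ : ℕ) (mid-at-peak : f k₀ ≡ mid) (peak : ∀ k → drift f k ≤ᶻ drift f k₀) where
        top : ℤ
        top = drift f k₀

        drift-after-peak : drift f (suc k₀) ≡ top
        drift-after-peak = trans (cong (λ s → tilt s +ᶻ top) mid-at-peak) (ℤP.+-identityˡ top)

        short-after-peak : f (suc k₀) ≡ short
        short-after-peak with f (suc k₀) in step
        ... | short = refl
        ... | mid   = ⊥-elim (no-mid-mid k₀ mid-at-peak step)
        ... | long  = ⊥-elim (suc≰ top (subst (_≤ᶻ top) rises (peak (suc (suc k₀)))))
          where
          rises : drift f (suc (suc k₀)) ≡ sucℤ top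
          rises = trans (cong (λ s → tilt s +ᶻ drift f (suc k₀)) step) (cong sucℤ drift-after-peak)

        below-top : sucℤ (drift f (suc (suc k₀))) ≡ top
        below-top = trans (cong (λ s → sucℤ (tilt s +ᶻ drift f (suc k₀))) short-after-peak) (trans (ℤP.suc-pred _) drift-after-peak)

        span : ℕ
        span = suc (suc (suc (suc (g * 2))))

        2+k₀+span : suc (suc k₀) + span ≡ k₀ + n
        2+k₀+span = lemma k₀ g
          where
          lemma : ∀ k g → suc (suc k) + suc (suc (suc (suc (g * 2)))) ≡ k + suc (suc (suc g)) * 2
          lemma = ℕSolver.solve-∀

        Canonical-from : Set
        Canonical-from = ∀ j → j < n → f (k₀ + j) ≡ canonical j

        module FirstLong (e : ℕ) (e<span : e < span) (long-at-e : f (suc (suc k₀) + e) ≡ long)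
                         (first : ∀ e' → e' < e → f (suc (suc k₀) + e') ≢ long) where
          valley ascent-start : ℕ
          valley = suc k₀ + e
          ascent-start = suc valley

          no-long-before : ∀ e' → e' < suc e → f (suc k₀ + e') ≢ long
          no-long-before zero    _   is-long = case trans (sym short-after-peak) (trans (cong f (sym (ℕP.+-identityʳ (suc k₀)))) is-long) of λ ()
          no-long-before (suc e') lt is-long = first e' (ℕP.≤-pred lt) (trans (cong f (sym (ℕP.+-suc (suc k₀) e'))) is-long)

          valley-mid : f valley ≡ mid
          valley-mid with f valley in step
          ... | short = ⊥-elim (no-short-long valley step long-at-e)
          ... | mid   = refl
          ... | long  = ⊥-elim (no-long-before e ℕP.≤-refl step)

          bottom : ℤ
          bottom = drift f valley

          drift-ascent-start : drift f ascent-start ≡ bottom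
          drift-ascent-start = trans (cong (λ s → tilt s +ᶻ bottom) valley-mid) (ℤP.+-identityˡ bottom)

          ascent-start<k₀+n : ascent-start < k₀ + n
          ascent-start<k₀+n = subst (ascent-start <_) 2+k₀+span (ℕP.+-monoʳ-< (suc (suc k₀)) e<span)

          rise : ℕ
          rise = proj₁ (ℕP.m≤n⇒∃[o]m+o≡n (ℕP.<⇒≤ ascent-start<k₀+n))

          ascent-end : ascent-start + rise ≡ k₀ + n
          ascent-end = proj₂ (ℕP.m≤n⇒∃[o]m+o≡n (ℕP.<⇒≤ ascent-start<k₀+n))

          descent-hits : ∀ p → bottom ≤ᶻ p → p ≤ᶻ top → Σ ℕ λ y → y ≤ e × drift f (suc k₀ + y) ≡ p
          descent-hits p lo hi = intermediate-down f (suc k₀) e p lo (subst (p ≤ᶻ_) (sym drift-after-peak) hi)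

          ascent-continues : ∀ δ → ascent-start + suc δ ≤ k₀ + n → (∀ e' → e' < δ → f (ascent-start + e') ≡ long) →
                             f (ascent-start + δ) ≡ long
          ascent-continues zero     _  _     = trans (cong f (ℕP.+-identityʳ ascent-start)) long-at-e
          ascent-continues (suc δ) le longs with f (ascent-start + suc δ) in step
          ... | long  = refl
          ... | short = ⊥-elim (no-long-short (ascent-start + δ) (longs δ ℕP.≤-refl) (trans (cong f (sym (ℕP.+-suc ascent-start δ))) step))
          ... | mid   = ⊥-elim (flat-unique-before (suc k₀ + y) j y<j 1+j<y+n hit flat)
            where
            j : ℕ
            j = ascent-start + suc δ
            drift-j : drift f j ≡ + suc δ +ᶻ bottom
            drift-j = trans (drift-long-run f ascent-start (suc δ) longs) (cong (+ suc δ +ᶻ_) drift-ascent-start)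
            flat : drift f j ≡ drift f (suc j)
            flat = sym (trans (cong (λ s → tilt s +ᶻ drift f j) step) (ℤP.+-identityˡ _))
            found : Σ ℕ λ y → y ≤ e × drift f (suc k₀ + y) ≡ drift f j
            found = descent-hits (drift f j) (subst (bottom ≤ᶻ_) (sym drift-j) (ℤP.i≤j+i bottom (+ suc δ))) (peak j)
            y : ℕ
            y = proj₁ found
            hit : drift f (suc k₀ + y) ≡ drift f j
            hit = proj₂ (proj₂ found)
            y<j : suc k₀ + y < j
            y<j = ℕP.≤-<-trans (ℕP.+-monoʳ-≤ (suc k₀) (proj₁ (proj₂ found))) (ℕP.<-≤-trans (ℕP.n<1+n valley) (ℕP.m≤m+n ascent-start (suc δ)))
            1+j<y+n : suc j < suc k₀ + y + n
            1+j<y+n = ℕP.≤-<-trans (subst (_≤ k₀ + n) (ℕP.+-suc ascent-start (suc δ)) le) (ℕP.+-monoˡ-< n (s≤s (ℕP.m≤m+n k₀ y)))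

          ascent-up-to : ∀ δ → ascent-start + δ ≤ k₀ + n → ∀ e' → e' < δ → f (ascent-start + e') ≡ long
          ascent-up-to (suc δ) le e' e'<1+δ with ℕP.m≤n⇒m<n∨m≡n (ℕP.≤-pred e'<1+δ)
          ... | inj₁ e'<δ = ascent-up-to δ le' e' e'<δ
            where
            le' : ascent-start + δ ≤ k₀ + n
            le' = ℕP.≤-trans (ℕP.+-monoʳ-≤ ascent-start (ℕP.n≤1+n δ)) le
          ... | inj₂ refl = ascent-continues δ le (ascent-up-to δ (ℕP.≤-trans (ℕP.+-monoʳ-≤ ascent-start (ℕP.n≤1+n δ)) le))

          ascent : ∀ e' → e' < rise → f (ascent-start + e') ≡ long
          ascent = ascent-up-to rise (ℕP.≤-reflexive ascent-end)

          top≡rise+bottom : top ≡ + rise +ᶻ bottom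
          top≡rise+bottom = begin
            top                             ≡⟨ drift-periodic k₀ ⟨
            drift f (k₀ + n)                ≡⟨ cong (drift f) ascent-end ⟨
            drift f (ascent-start + rise)   ≡⟨ drift-long-run f ascent-start rise ascent ⟩
            + rise +ᶻ drift f ascent-start  ≡⟨ cong (+ rise +ᶻ_) drift-ascent-start ⟩
            + rise +ᶻ bottom                ∎
            where open ≡-Reasoning

          descent : ∀ e' → e' < e → f (suc k₀ + e') ≡ short
          descent e' e'<e with f (suc k₀ + e') in step
          ... | short = refl
          ... | long  = ⊥-elim (no-long-before e' (ℕP.m≤n⇒m≤1+n e'<e) step)
          ... | mid   = ⊥-elim (flat-unique-after u (ascent-start + x) 1+u<x x<u+n flat hit)
            where
            u : ℕ
            u = suc k₀ + e'
            flat : drift f u ≡ drift f (suc u)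
            flat = sym (trans (cong (λ s → tilt s +ᶻ drift f u) step) (ℤP.+-identityˡ _))
            r : ℕ
            r = proj₁ (ℕP.m≤n⇒∃[o]m+o≡n e'<e)
            1+e'+r≡e : suc e' + r ≡ e
            1+e'+r≡e = proj₂ (ℕP.m≤n⇒∃[o]m+o≡n e'<e)
            shift : ∀ x → suc u + x ≡ suc k₀ + (suc e' + x)
            shift x = lemma k₀ e' x
              where
              lemma : ∀ k e' x → suc (suc k + e') + x ≡ suc k + (suc e' + x)
              lemma = ℕSolver.solve-∀
            bottom≤ : bottom ≤ᶻ drift f u
            bottom≤ = subst₂ _≤ᶻ_ (cong (drift f) (trans (shift r) (cong (suc k₀ ℕ.+_) 1+e'+r≡e))) (sym flat)
              (drift-no-long f (suc u) r λ x x<r is-long →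
                no-long-before (suc e' + x) (ℕP.<-trans (subst (suc e' + x <_) 1+e'+r≡e (ℕP.+-monoʳ-< (suc e') x<r)) (ℕP.n<1+n e))
                               (trans (cong f (sym (shift x))) is-long))
            found : Σ ℕ λ x → x ≤ rise × drift f (ascent-start + x) ≡ drift f u
            found = intermediate-up f ascent-start rise (drift f u) (subst (_≤ᶻ drift f u) (sym drift-ascent-start) bottom≤)
                      (subst (drift f u ≤ᶻ_) (sym (trans (cong (drift f) ascent-end) (drift-periodic k₀))) (peak u))
            x : ℕ
            x = proj₁ found
            hit : drift f (ascent-start + x) ≡ drift f u
            hit = proj₂ (proj₂ found)
            1+u<x : suc u < ascent-start + x
            1+u<x = ℕP.≤-<-trans (subst (_≤ valley) (ℕP.+-suc (suc k₀) e') (ℕP.+-monoʳ-≤ (suc k₀) e'<e))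
                      (ℕP.<-≤-trans (ℕP.n<1+n valley) (ℕP.m≤m+n ascent-start x))
            x<u+n : ascent-start + x < u + n
            x<u+n = ℕP.≤-<-trans (subst (ascent-start + x ≤_) ascent-end (ℕP.+-monoʳ-≤ ascent-start (proj₁ (proj₂ found))))
                      (ℕP.+-monoˡ-< n (s≤s (ℕP.m≤m+n k₀ e')))

          top≡e+bottom : top ≡ + e +ᶻ bottom
          top≡e+bottom = trans (sym drift-after-peak) (drift-short-run f (suc k₀) e descent)

          e≡rise : e ≡ rise
          e≡rise = ℤP.+-injective (+ᶻ-cancelʳ bottom (+ e) (+ rise) (trans (sym top≡e+bottom) top≡rise+bottom))

          e≡ℓ : e ≡ ℓ
          e≡ℓ = ℕP.*-cancelʳ-≡ e ℓ 2 (ℕP.suc-injective (ℕP.suc-injective (ℕP.+-cancelˡ-≡ k₀ _ _ (begin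
            k₀ + suc (suc (e * 2))  ≡⟨ lemma k₀ e ⟨
            suc (suc k₀ + e) + e    ≡⟨ cong (ascent-start ℕ.+_) e≡rise ⟩
            ascent-start + rise     ≡⟨ ascent-end ⟩
            k₀ + n                  ∎))))
            where
            open ≡-Reasoning
            lemma : ∀ k e → suc (suc k + e) + e ≡ k + suc (suc (e * 2))
            lemma = ℕSolver.solve-∀

          canonical-from : Canonical-from
          canonical-from zero    _    = trans (cong f (ℕP.+-identityʳ k₀)) mid-at-peak
          canonical-from (suc j) 1+j<n = by-position (ℕP.<-cmp j ℓ)
            where
            by-position : Tri (j < ℓ) (j ≡ ℓ) (ℓ < j) → f (k₀ + suc j) ≡ canonical (suc j)
            by-position (tri< j<ℓ _ _) =
              trans (cong f (ℕP.+-suc k₀ j)) (trans (descent j (subst (j <_) (sym e≡ℓ) j<ℓ)) (sym (canonical-short j j<ℓ)))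
            by-position (tri≈ _ refl _) =
              trans (cong f (trans (ℕP.+-suc k₀ ℓ) (cong (suc k₀ ℕ.+_) (sym e≡ℓ)))) (trans valley-mid (sym canonical-mid))
            by-position (tri> _ _ ℓ<j) with ℕP.m≤n⇒∃[o]m+o≡n ℓ<j
            ... | e'' , refl = trans (cong f shift) (trans (ascent e'' e''<rise) (sym (canonical-long (suc ℓ + e'') ℓ<j)))
              where
              shift : k₀ + suc (suc ℓ + e'') ≡ ascent-start + e''
              shift = trans (lemma k₀ ℓ e'') (cong (λ z → suc (suc k₀ + z) + e'') (sym e≡ℓ))
                where
                lemma : ∀ k l x → k + suc (suc l + x) ≡ suc (suc k + l) + x
                lemma = ℕSolver.solve-∀
              e''<ℓ : e'' < ℓ
              e''<ℓ = ℕP.+-cancelˡ-≤ ℓ (suc e'') ℓ (subst (_≤ ℓ + ℓ) (sym (ℕP.+-suc ℓ e''))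
                        (ℕP.≤-pred (ℕP.≤-pred (subst (suc (suc (suc (ℓ + e''))) ≤_) n≡2+ℓ+ℓ 1+j<n))))
              e''<rise : e'' < rise
              e''<rise = subst (e'' <_) (trans (sym e≡ℓ) e≡rise) e''<ℓ

        canonical-after-peak : Canonical-from
        canonical-after-peak with first-long f (suc (suc k₀)) span
        ... | inj₂ (e , e<span , long-at-e , first) = FirstLong.canonical-from e e<span long-at-e first
        ... | inj₁ none = ⊥-elim (suc≰ (drift f (suc (suc k₀))) (subst (_≤ᶻ drift f (suc (suc k₀))) returns (drift-no-long f (suc (suc k₀)) span none)))
          where
          returns : drift f (suc (suc k₀) + span) ≡ sucℤ (drift f (suc (suc k₀)))
          returns = trans (cong (drift f) 2+k₀+span) (trans (drift-periodic k₀) (sym below-top))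

      rotation : Rotation f
      rotation with global-max
      ... | M , max with mid-at-max M max
      ...   | k₀ , mid-at-k₀ , same = realign periodic k₀ (FromPeak.canonical-after-peak k₀ mid-at-k₀ (λ k → subst (drift f k ≤ᶻ_) (sym same) (max k)))

    classify : drift f n ≋ + 0 → Rotation f ⊎ (2 ∣ h × (∀ k → f k ≡ short)) ⊎ (2 ∣ h × (∀ k → f k ≡ long))
    classify closes with drift-closes last f closes
    ... | inj₁ balanced       = inj₁ (Balanced.rotation balanced)
    ... | inj₂ (inj₁ longs)   = inj₂ (inj₂ (constant⇒even long (λ ()) longs , constant long longs))
    ... | inj₂ (inj₂ shorts)  = inj₂ (inj₁ (constant⇒even short (λ ()) shorts , constant short shorts))


  step-dist : Step → ℕ
  step-dist s = len s ⊓ (n ∸ len s)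

  len<n : ∀ s → len s < n
  len<n short = ℕP.<-trans (ℕP.n<1+n ℓ) h<n
  len<n mid   = h<n
  len<n long  = subst (suc h <_) (sym n≡ℓ+1+h) (ℕP.m<n+m (suc h) {ℓ} (s≤s z≤n))

  step-dist-short : step-dist short ≡ ℓ
  step-dist-short = trans (cong (ℓ ⊓_) (trans (cong (_∸ ℓ) n≡ℓ+1+h) (ℕP.m+n∸m≡n ℓ (suc h))))
                          (ℕP.m≤n⇒m⊓n≡m (ℕP.≤-trans (ℕP.n≤1+n ℓ) (ℕP.n≤1+n h)))

  step-dist-long : step-dist long ≡ ℓ
  step-dist-long = trans (cong (suc h ⊓_) (trans (cong (_∸ suc h) (trans n≡ℓ+1+h (ℕP.+-comm ℓ (suc h)))) (ℕP.m+n∸m≡n (suc h) ℓ)))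
                         (ℕP.m≥n⇒m⊓n≡n (ℕP.≤-trans (ℕP.n≤1+n ℓ) (ℕP.n≤1+n h)))

  step-dist-mid : step-dist mid ≡ h
  step-dist-mid = trans (cong (h ⊓_) (trans (cong (_∸ h) n≡h+h) (ℕP.m+n∸m≡n h h))) (ℕP.⊓-idem h)

  ℓ≤step-dist : ∀ s → ℓ ≤ step-dist s
  ℓ≤step-dist short = ℕP.≤-reflexive (sym step-dist-short)
  ℓ≤step-dist mid   = subst (ℓ ≤_) (sym step-dist-mid) (ℕP.n≤1+n ℓ)
  ℓ≤step-dist long  = ℕP.≤-reflexive (sym step-dist-long)

  distℕ-+ : ∀ a δ → distℕ a (a + δ) ≡ δ ⊓ (n ∸ δ)
  distℕ-+ a δ = cong (λ z → z ⊓ (n ∸ z)) (ℕP.∣m-m+n∣≡n a δ)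

  distℕ-step : ∀ a s → a < n → distℕ a ((a + len s) % n) ≡ step-dist s
  distℕ-step a s a<n with ℕP.<-≤-connex (a + len s) n
  ... | inj₁ lt = trans (cong (distℕ a) (m<n⇒m%n≡m lt)) (distℕ-+ a (len s))
  ... | inj₂ ge with ℕP.m≤n⇒∃[o]m+o≡n ge
  ...   | c , n+c≡ = begin
    distℕ a ((a + len s) % n)        ≡⟨ cong (distℕ a) wrapped ⟩
    distℕ a c                        ≡⟨ distℕ-comm a c ⟩
    distℕ c a                        ≡⟨ cong (distℕ c) a≡ ⟩
    distℕ c (c + (n ∸ len s))        ≡⟨ distℕ-+ c (n ∸ len s) ⟩
    (n ∸ len s) ⊓ (n ∸ (n ∸ len s))  ≡⟨ cong ((n ∸ len s) ⊓_) (ℕP.m∸[m∸n]≡n (ℕP.<⇒≤ (len<n s))) ⟩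
    (n ∸ len s) ⊓ len s              ≡⟨ ℕP.⊓-comm _ _ ⟩
    step-dist s                      ∎
    where
    open ≡-Reasoning
    a+len≡c+n : a + len s ≡ c + n
    a+len≡c+n = trans (sym n+c≡) (ℕP.+-comm n c)
    wrapped : (a + len s) % n ≡ c
    wrapped = trans (cong (_% n) a+len≡c+n) (trans ([m+n]%n≡m%n c n)
                (m<n⇒m%n≡m (ℕP.+-cancelʳ-< n c n (subst (_< n + n) a+len≡c+n (ℕP.+-mono-< a<n (len<n s))))))
    a≡ : a ≡ c + (n ∸ len s)
    a≡ = ℕP.+-cancelʳ-≡ (len s) a _ (trans a+len≡c+n
           (trans (cong (c ℕ.+_) (sym (ℕP.m∸n+n≡m (ℕP.<⇒≤ (len<n s))))) (sym (ℕP.+-assoc c _ (len s)))))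

  near-half : ∀ δ → δ ≤ n → ℓ ≤ δ ⊓ (n ∸ δ) → Σ ℕ λ r → δ ≡ ℓ + r × r ≤ 2
  near-half δ δ≤n ℓ≤ with ℕP.m≤n⇒∃[o]m+o≡n (ℕP.≤-trans ℓ≤ (ℕP.m⊓n≤m δ _))
  ... | r , refl = r , refl , ℕP.+-cancelˡ-≤ ℓ r 2 (ℕP.+-cancelˡ-≤ ℓ _ _ (subst (ℓ + (ℓ + r) ≤_) n≡ℓ+ℓ+2
                     (subst (ℓ + (ℓ + r) ≤_) (ℕP.m∸n+n≡m δ≤n) (ℕP.+-monoˡ-≤ (ℓ + r) (ℕP.≤-trans ℓ≤ (ℕP.m⊓n≤n _ _))))))
    where
    n≡ℓ+ℓ+2 : n ≡ ℓ + (ℓ + 2)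
    n≡ℓ+ℓ+2 = lemma g
      where
      lemma : ∀ g → suc (suc (suc g)) * 2 ≡ suc (suc g) + (suc (suc g) + 2)
      lemma = ℕSolver.solve-∀

  step-between : ∀ a b → a < n → b < n → ℓ ≤ distℕ a b → Σ Step λ s → (a + len s) % n ≡ b
  step-between a b a<n b<n ℓ≤ with ℕP.≤-total a b
  ... | inj₁ a≤b with ℕP.m≤n⇒∃[o]m+o≡n a≤b
  ...   | δ , refl with near-half δ (ℕP.≤-trans (ℕP.m≤n+m δ a) (ℕP.<⇒≤ b<n)) (subst (ℓ ≤_) (distℕ-+ a δ) ℓ≤)
  ...     | 0 , refl , _ = short , trans (cong (λ z → (a + z) % n) (sym (ℕP.+-identityʳ ℓ))) (m<n⇒m%n≡m b<n)
  ...     | 1 , refl , _ = mid   , trans (cong (λ z → (a + z) % n) (ℕP.+-comm 1 ℓ)) (m<n⇒m%n≡m b<n)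
  ...     | 2 , refl , _ = long  , trans (cong (λ z → (a + z) % n) (ℕP.+-comm 2 ℓ)) (m<n⇒m%n≡m b<n)
  ...     | suc (suc (suc _)) , _ , s≤s (s≤s ())
  step-between a b a<n b<n ℓ≤ | inj₂ b≤a with ℕP.m≤n⇒∃[o]m+o≡n b≤a
  ...   | δ , refl with near-half δ (ℕP.≤-trans (ℕP.m≤n+m δ b) (ℕP.<⇒≤ a<n)) (subst (ℓ ≤_) (trans (distℕ-comm (b + δ) b) (distℕ-+ b δ)) ℓ≤)
  ...     | r , refl , r≤2 with complement r r≤2
    where
    complement : ∀ r → r ≤ 2 → Σ Step λ s → ℓ + r + len s ≡ n
    complement 0 _ = long  , trans (cong (_+ suc h) (ℕP.+-identityʳ ℓ)) (sym n≡ℓ+1+h)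
    complement 1 _ = mid   , trans (cong (_+ h) (ℕP.+-comm ℓ 1)) (sym n≡h+h)
    complement 2 _ = short , trans (cong (_+ ℓ) (ℕP.+-comm ℓ 2)) (trans (ℕP.+-comm (suc h) ℓ) (sym n≡ℓ+1+h))
    complement (suc (suc (suc _))) (s≤s (s≤s ()))
  ...       | s , full-turn = s , (begin
    (b + (ℓ + r) + len s) % n  ≡⟨ cong (_% n) (trans (ℕP.+-assoc b (ℓ + r) (len s)) (cong (b ℕ.+_) full-turn)) ⟩
    (b + n) % n                ≡⟨ [m+n]%n≡m%n b n ⟩
    b % n                      ≡⟨ m<n⇒m%n≡m b<n ⟩
    b                          ∎)
    where open ≡-Reasoning

  len-injective-mod : ∀ a s s' → (a + len s) % n ≡ (a + len s') % n → s ≡ s'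
  len-injective-mod a s s' e = len-injective s s' (≋⇒≡ (len s) (len s') (len<n s) (len<n s') (≋-cancelʳ (+ a) (begin
    + len s +ᶻ + a   ≡⟨ ℤP.+-comm (+ len s) (+ a) ⟩
    + a +ᶻ + len s   ≡⟨ ℤP.pos-+ a (len s) ⟨
    + (a + len s)    ≈⟨ %≡⇒≋ _ _ e ⟩
    + (a + len s')   ≡⟨ ℤP.pos-+ a (len s') ⟩
    + a +ᶻ + len s'  ≡⟨ ℤP.+-comm (+ a) (+ len s') ⟩
    + len s' +ᶻ + a  ∎)))
    where
    open ≋-Reasoning
    len-injective : ∀ s s' → len s ≡ len s' → s ≡ s'
    len-injective short short _ = refl
    len-injective short mid   e = ⊥-elim (ℕP.<-irrefl e (ℕP.n<1+n ℓ))
    len-injective short long  e = ⊥-elim (ℕP.<-irrefl e (ℕP.<-trans (ℕP.n<1+n ℓ) (ℕP.n<1+n h)))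
    len-injective mid   short e = ⊥-elim (ℕP.<-irrefl (sym e) (ℕP.n<1+n ℓ))
    len-injective mid   mid   _ = refl
    len-injective mid   long  e = ⊥-elim (ℕP.<-irrefl e (ℕP.n<1+n h))
    len-injective long  short e = ⊥-elim (ℕP.<-irrefl (sym e) (ℕP.<-trans (ℕP.n<1+n ℓ) (ℕP.n<1+n h)))
    len-injective long  mid   e = ⊥-elim (ℕP.<-irrefl (sym e) (ℕP.n<1+n h))
    len-injective long  long  _ = refl

  position≋drift : ∀ f → position f n ≋ drift f n
  position≋drift f = differ-by H (ℤP.+-comm (H *ᶻ + n) (drift f n))

  Admissible : Word → Set
  Admissible f = Periodic n f × WindowInjective f × drift f n ≋ + 0

  module WordOfRow {R : ℕ → ℕ} (row : Row R) where
    open Row row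

    ℓ≤spread : ∀ k → ℓ ≤ distℕ (R k) (R (suc k))
    ℓ≤spread k = subst (_≤ distℕ (R k) (R (suc k))) d≡ℓ (spread k)

    word : Word
    word k = proj₁ (step-between (R k) (R (suc k)) (bounded k) (bounded (suc k)) (ℓ≤spread k))

    word-step : ∀ k → (R k + len (word k)) % n ≡ R (suc k)
    word-step k = proj₂ (step-between (R k) (R (suc k)) (bounded k) (bounded (suc k)) (ℓ≤spread k))

    walk-word : ∀ k → walk word k ≡ R k
    walk-word zero    = sym starts-0
    walk-word (suc k) = trans (cong (λ z → (z + len (word k)) % n) (walk-word k)) (word-step k)

    word-admissible : Admissible word
    word-admissible = periodic-word , window-injective , closes
      where
      periodic-word : Periodic n word
      periodic-word k = len-injective-mod (R k) (word (k + n)) (word k)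
        (trans (cong (λ z → (z + len (word (k + n))) % n) (sym (periodic k)))
               (trans (word-step (k + n)) (trans (periodic (suc k)) (sym (word-step k)))))
      walk≋ : ∀ x → + R x ≋ position word x
      walk≋ x = subst (λ z → + z ≋ position word x) (walk-word x) (walk≋position word x)
      window-injective : WindowInjective word
      window-injective x y x<y y<x+n same = %-injective-on-window x y x<y y<x+n
        (injective _ _ (m%n<n x n) (m%n<n y n) (trans (sym (≡% x)) (trans Rx≡Ry (≡% y))))
        where
        Rx≡Ry : R x ≡ R y
        Rx≡Ry = ≋⇒≡ _ _ (bounded x) (bounded y) (≋-trans (walk≋ x) (≋-trans same (≋-sym (walk≋ y))))
      closes : drift word n ≋ + 0
      closes = ≋-trans (≋-sym (position≋drift word)) (≋-trans (≋-sym (walk≋ n)) (≡⇒≋ (cong +_ (trans (periodic 0) starts-0))))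

  module RowOfWord {f : Word} (admissible : Admissible f) where
    periodic : Periodic n f
    periodic = proj₁ admissible

    injective : WindowInjective f
    injective = proj₁ (proj₂ admissible)

    closes : drift f n ≋ + 0
    closes = proj₂ (proj₂ admissible)

    walk-n : walk f n ≡ 0
    walk-n = ≋⇒≡ _ _ (walk<n f n) (s≤s z≤n) (≋-trans (walk≋position f n) (≋-trans (position≋drift f) closes))

    walk-periodic : ∀ k → walk f (k + n) ≡ walk f k
    walk-periodic zero    = walk-n
    walk-periodic (suc k) = cong₂ (λ a s → (a + len s) % n) (walk-periodic k) (periodic k)

    walk-distinct : ∀ x y → x < y → y < n → walk f x ≢ walk f y
    walk-distinct x y x<y y<n e = injective x y x<y (ℕP.<-≤-trans y<n (ℕP.m≤n+m n x))
      (≋-trans (≋-sym (walk≋position f x)) (≋-trans (≡⇒≋ (cong +_ e)) (walk≋position f y)))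

    walk-injective : ∀ x y → x < n → y < n → walk f x ≡ walk f y → x ≡ y
    walk-injective x y x<n y<n e with ℕP.<-cmp x y
    ... | tri< x<y _ _ = ⊥-elim (walk-distinct x y x<y y<n e)
    ... | tri≈ _ x≡y _ = x≡y
    ... | tri> _ _ y<x = ⊥-elim (walk-distinct y x y<x x<n (sym e))

    walk-row : Row (walk f)
    walk-row = record
      { periodic  = walk-periodic
      ; bounded   = walk<n f
      ; starts-0  = refl
      ; injective = walk-injective
      ; spread    = λ k → subst₂ _≤_ (sym d≡ℓ) (sym (distℕ-step (walk f k) (f k) (walk<n f k))) (ℓ≤step-dist (f k))
      }

    dist-step-to-d : ∀ k s → f k ≡ s → step-dist s ≡ ℓ → distℕ (walk f k) (walk f (suc k)) ≡ d
    dist-step-to-d k s fk≡s dist≡ℓ = trans (distℕ-step (walk f k) (f k) (walk<n f k)) (trans (cong step-dist fk≡s) (trans dist≡ℓ (sym d≡ℓ)))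

    walk-attains : Attains (walk f)
    walk-attains with f 0 in step₀ | f 1 in step₁
    ... | short | _     = 0 , s≤s (s≤s z≤n) , dist-step-to-d 0 short step₀ step-dist-short
    ... | long  | _     = 0 , s≤s (s≤s z≤n) , dist-step-to-d 0 long step₀ step-dist-long
    ... | mid   | short = 1 , s≤s (s≤s (s≤s z≤n)) , dist-step-to-d 1 short step₁ step-dist-short
    ... | mid   | long  = 1 , s≤s (s≤s (s≤s z≤n)) , dist-step-to-d 1 long step₁ step-dist-long
    ... | mid   | mid   = ⊥-elim (LocalConstraints.no-mid-mid injective 0 step₀ step₁)


  cyclic : Word
  cyclic k = canonical (k % n)

  cyclic-periodic : Periodic n cyclic
  cyclic-periodic k = cong canonical ([m+n]%n≡m%n k n)

  cyclic≡canonical : ∀ i → i < n → cyclic i ≡ canonical i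
  cyclic≡canonical i i<n = cong canonical (m<n⇒m%n≡m i<n)

  descent-depth : ∀ e → e ≤ ℓ → + e +ᶻ drift cyclic (suc e) ≡ + 0
  descent-depth e e≤ℓ = sym (drift-short-run cyclic 1 e λ e' e'<e →
    trans (cyclic≡canonical (suc e') (ℕP.<-trans (s≤s (ℕP.<-≤-trans e'<e e≤ℓ)) h<n)) (canonical-short e' (ℕP.<-≤-trans e'<e e≤ℓ)))

  drift-bottom : drift cyclic (suc (suc ℓ)) ≡ drift cyclic (suc ℓ)
  drift-bottom = trans (cong (λ s → tilt s +ᶻ drift cyclic (suc ℓ)) (trans (cyclic≡canonical (suc ℓ) h<n) canonical-mid)) (ℤP.+-identityˡ _)

  ascent-depth : ∀ e → e ≤ ℓ → drift cyclic (suc (suc ℓ) + e) +ᶻ + ℓ ≡ + e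
  ascent-depth e e≤ℓ = begin
    drift cyclic (suc (suc ℓ) + e) +ᶻ + ℓ     ≡⟨ cong (_+ᶻ + ℓ) (drift-long-run cyclic (suc (suc ℓ)) e longs) ⟩
    + e +ᶻ drift cyclic (suc (suc ℓ)) +ᶻ + ℓ  ≡⟨ cong (λ z → + e +ᶻ z +ᶻ + ℓ) drift-bottom ⟩
    + e +ᶻ drift cyclic (suc ℓ) +ᶻ + ℓ        ≡⟨ lemma (+ e) (drift cyclic (suc ℓ)) (+ ℓ) ⟩
    + e +ᶻ (+ ℓ +ᶻ drift cyclic (suc ℓ))      ≡⟨ cong (+ e +ᶻ_) (descent-depth ℓ ℕP.≤-refl) ⟩
    + e +ᶻ + 0                                ≡⟨ ℤP.+-identityʳ (+ e) ⟩
    + e                                       ∎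
    where
    open ≡-Reasoning
    lemma : ∀ e p l → e +ᶻ p +ᶻ l ≡ e +ᶻ (l +ᶻ p)
    lemma = solve-∀
    longs : ∀ e' → e' < e → cyclic (suc (suc ℓ) + e') ≡ long
    longs e' e'<e = trans (cyclic≡canonical _ (subst (suc (suc ℓ) + e' <_) (sym n≡2+ℓ+ℓ) (s≤s (s≤s (ℕP.+-monoʳ-< ℓ (ℕP.<-≤-trans e'<e e≤ℓ))))))
                          (canonical-long (suc ℓ + e') (s≤s (ℕP.m≤m+n ℓ e')))

  cyclic-balanced : drift cyclic n ≡ + 0
  cyclic-balanced = +ᶻ-cancelʳ (+ ℓ) (drift cyclic n) (+ 0) (trans (cong (λ z → drift cyclic z +ᶻ + ℓ) n≡2+ℓ+ℓ)
                      (trans (ascent-depth ℓ ℕP.≤-refl) (sym (ℤP.+-identityˡ (+ ℓ)))))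

  -- Along the canonical word the drift at index k is − D for Region k D: D = 0 at
  -- index 0, D at index D + 1, and D at index 2ℓ + 2 − D on the ascent. Indices of
  -- equal depth are an odd distance apart.
  Region : ℕ → ℕ → Set
  Region k D = (k ≡ 0 × D ≡ 0) ⊎ (k ≡ suc D) ⊎ (Σ ℕ λ e → k ≡ suc (suc ℓ) + e × e < ℓ × D + e ≡ ℓ)

  depth : ∀ k → k < n → Σ ℕ λ D → D < h × (+ D +ᶻ drift cyclic k ≡ + 0) × Region k D
  depth zero    _   = 0 , s≤s z≤n , refl , inj₁ (refl , refl)
  depth (suc e) k<n with ℕP.≤-<-connex e ℓ
  ... | inj₁ e≤ℓ = e , s≤s e≤ℓ , descent-depth e e≤ℓ , inj₂ (inj₁ refl)
  ... | inj₂ ℓ<e with ℕP.m≤n⇒∃[o]m+o≡n ℓ<e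
  ...   | e' , refl = ℓ ∸ e' , s≤s (ℕP.m∸n≤m ℓ e') , depth≡ , inj₂ (inj₂ (e' , refl , e'<ℓ , ℕP.m∸n+n≡m (ℕP.<⇒≤ e'<ℓ)))
    where
    e'<ℓ : e' < ℓ
    e'<ℓ = ℕP.+-cancelˡ-< ℓ e' ℓ (ℕP.≤-pred (ℕP.≤-pred (subst (suc (suc (suc ℓ + e')) ≤_) n≡2+ℓ+ℓ k<n)))
    depth≡ : + (ℓ ∸ e') +ᶻ drift cyclic (suc (suc ℓ + e')) ≡ + 0
    depth≡ = +ᶻ-cancelʳ (+ e') _ _ (begin
      + (ℓ ∸ e') +ᶻ drift cyclic (suc (suc ℓ) + e') +ᶻ + e'    ≡⟨ lemma (+ (ℓ ∸ e')) (drift cyclic (suc (suc ℓ) + e')) (+ e') ⟩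
      drift cyclic (suc (suc ℓ) + e') +ᶻ (+ (ℓ ∸ e') +ᶻ + e')  ≡⟨ cong (drift cyclic (suc (suc ℓ) + e') +ᶻ_) (trans (sym (ℤP.pos-+ (ℓ ∸ e') e')) (cong +_ (ℕP.m∸n+n≡m (ℕP.<⇒≤ e'<ℓ)))) ⟩
      drift cyclic (suc (suc ℓ) + e') +ᶻ + ℓ                   ≡⟨ ascent-depth e' (ℕP.<⇒≤ e'<ℓ) ⟩
      + e'                                                     ≡⟨ ℤP.+-identityˡ (+ e') ⟨
      + 0 +ᶻ + e'                                              ∎)
      where
      open ≡-Reasoning
      lemma : ∀ a p b → a +ᶻ p +ᶻ b ≡ p +ᶻ (a +ᶻ b)
      lemma = solve-∀

  odd≢even : ∀ m k → m * 2 ≢ suc (k * 2)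
  odd≢even zero          k       ()
  odd≢even (suc zero)    zero    ()
  odd≢even (suc zero)    (suc k) ()
  odd≢even (suc (suc m)) zero    ()
  odd≢even (suc (suc m)) (suc k) e = odd≢even (suc m) k (ℕP.suc-injective (ℕP.suc-injective e))

  same-depth-odd-gap : ∀ a b D → Region a D → Region b D → a < b → ∀ m → b ≢ a + m * 2
  same-depth-odd-gap a b D (inj₁ (refl , refl)) (inj₁ (refl , _)) () m e
  same-depth-odd-gap a b D (inj₁ (refl , refl)) (inj₂ (inj₁ refl)) a<b m e = odd≢even m 0 (sym e)
  same-depth-odd-gap a b D (inj₁ (refl , refl)) (inj₂ (inj₂ (e₂ , _ , e₂<ℓ , De))) a<b m e = ℕP.<-irrefl De e₂<ℓ
  same-depth-odd-gap a b D (inj₂ (inj₁ refl)) (inj₁ (refl , _)) () m e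
  same-depth-odd-gap a b D (inj₂ (inj₁ refl)) (inj₂ (inj₁ refl)) a<b m e = ℕP.<-irrefl refl a<b
  same-depth-odd-gap a b D (inj₂ (inj₁ refl)) (inj₂ (inj₂ (e₂ , refl , e₂<ℓ , De))) a<b m e =
    odd≢even m e₂ (ℕP.+-cancelˡ-≡ (suc D) (m * 2) (suc (e₂ * 2)) (trans (sym e) (trans (cong (λ z → suc (suc z) + e₂) (sym De)) (lemma D e₂))))
    where
    lemma : ∀ D e → suc (suc (D + e)) + e ≡ suc D + suc (e * 2)
    lemma = ℕSolver.solve-∀
  same-depth-odd-gap a b D (inj₂ (inj₂ (e₁ , refl , _ , De₁))) (inj₁ (refl , _)) () m e
  same-depth-odd-gap a b D (inj₂ (inj₂ (e₁ , refl , _ , De₁))) (inj₂ (inj₁ refl)) a<b m e =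
    ℕP.<-asym a<b (s≤s (s≤s (ℕP.≤-trans (subst (D ≤_) De₁ (ℕP.m≤m+n D e₁)) (ℕP.m≤m+n ℓ e₁))))
  same-depth-odd-gap a b D (inj₂ (inj₂ (e₁ , refl , _ , De₁))) (inj₂ (inj₂ (e₂ , refl , _ , De₂))) a<b m e =
    ℕP.<-irrefl (cong (suc (suc ℓ) ℕ.+_) (ℕP.+-cancelˡ-≡ D e₁ e₂ (trans De₁ (sym De₂)))) a<b

  module ModH = Congruence (suc (suc g))

  +n≡H+H : + n ≡ H +ᶻ H
  +n≡H+H = trans (cong +_ n≡h+h) (ℤP.pos-+ h h)

  in-halves : ∀ {f a b q} → position f a ≡ position f b +ᶻ q *ᶻ + n →
              H *ᶻ + a +ᶻ drift f a ≡ H *ᶻ + b +ᶻ drift f b +ᶻ q *ᶻ (H +ᶻ H)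
  in-halves {f} {b = b} {q} e = trans e (cong (λ z → position f b +ᶻ q *ᶻ z) +n≡H+H)

  depths-congruent : ∀ a b Pa Pb Da Db q → Da +ᶻ Pa ≡ + 0 → Db +ᶻ Pb ≡ + 0 →
                     H *ᶻ a +ᶻ Pa ≡ H *ᶻ b +ᶻ Pb +ᶻ q *ᶻ (H +ᶻ H) → Da ≡ Db +ᶻ (a -ᶻ b -ᶻ q *ᶻ + 2) *ᶻ H
  depths-congruent a b Pa Pb Da Db q da db positions = begin
    Da                                                    ≡⟨ expand H a b Pa Pb Da Db q ⟩
    Db +ᶻ K *ᶻ H +ᶻ (Da +ᶻ Pa) -ᶻ (Db +ᶻ Pb) -ᶻ (X -ᶻ Y)  ≡⟨ cong₂ (λ u v → Db +ᶻ K *ᶻ H +ᶻ u -ᶻ v -ᶻ (X -ᶻ Y)) da db ⟩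
    Db +ᶻ K *ᶻ H +ᶻ + 0 -ᶻ + 0 -ᶻ (X -ᶻ Y)                ≡⟨ cong (λ u → Db +ᶻ K *ᶻ H +ᶻ + 0 -ᶻ + 0 -ᶻ (u -ᶻ Y)) positions ⟩
    Db +ᶻ K *ᶻ H +ᶻ + 0 -ᶻ + 0 -ᶻ (Y -ᶻ Y)                ≡⟨ collapse Db (K *ᶻ H) Y ⟩
    Db +ᶻ K *ᶻ H                                          ∎
    where
    open ≡-Reasoning
    K X Y : ℤ
    K = a -ᶻ b -ᶻ q *ᶻ + 2
    X = H *ᶻ a +ᶻ Pa
    Y = H *ᶻ b +ᶻ Pb +ᶻ q *ᶻ (H +ᶻ H)
    expand : ∀ H a b Pa Pb Da Db q → Da ≡ Db +ᶻ (a -ᶻ b -ᶻ q *ᶻ + 2) *ᶻ H +ᶻ (Da +ᶻ Pa) -ᶻ (Db +ᶻ Pb)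
                                            -ᶻ ((H *ᶻ a +ᶻ Pa) -ᶻ (H *ᶻ b +ᶻ Pb +ᶻ q *ᶻ (H +ᶻ H)))
    expand = solve-∀
    collapse : ∀ d k y → d +ᶻ k +ᶻ + 0 -ᶻ + 0 -ᶻ (y -ᶻ y) ≡ d +ᶻ k
    collapse = solve-∀

  indices-congruent : ∀ a b p q → H *ᶻ a +ᶻ p ≡ H *ᶻ b +ᶻ p +ᶻ q *ᶻ (H +ᶻ H) → a ≡ b +ᶻ q *ᶻ + 2
  indices-congruent a b p q e = ℤP.*-cancelˡ-≡ H a (b +ᶻ q *ᶻ + 2) (trans (lemma₁ H a p) (trans (cong (_-ᶻ p) e) (lemma₂ H b p q)))
    where
    lemma₁ : ∀ H a p → H *ᶻ a ≡ H *ᶻ a +ᶻ p -ᶻ p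
    lemma₁ = solve-∀
    lemma₂ : ∀ H b p q → H *ᶻ b +ᶻ p +ᶻ q *ᶻ (H +ᶻ H) -ᶻ p ≡ H *ᶻ (b +ᶻ q *ᶻ + 2)
    lemma₂ = solve-∀

  doubled⇒even : ∀ d z → + d ≡ z *ᶻ + 2 → Σ ℕ λ m → d ≡ m * 2
  doubled⇒even d (+ m)     e = m , ℤP.+-injective (trans e (sym (ℤP.pos-* m 2)))
  doubled⇒even d -[1+ m ] ()

  even-gap : ∀ a d q → + a ≡ + (a + d) +ᶻ q *ᶻ + 2 → Σ ℕ λ m → d ≡ m * 2
  even-gap a d q e = doubled⇒even d (-ᶻ q) (begin
    + d                                               ≡⟨ lemma₁ (+ a) (+ d) q ⟩
    (-ᶻ q) *ᶻ + 2 +ᶻ (+ a +ᶻ + d +ᶻ q *ᶻ + 2 -ᶻ + a)  ≡⟨ cong (λ z → (-ᶻ q) *ᶻ + 2 +ᶻ (z +ᶻ q *ᶻ + 2 -ᶻ + a)) (ℤP.pos-+ a d) ⟨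
    (-ᶻ q) *ᶻ + 2 +ᶻ (+ (a + d) +ᶻ q *ᶻ + 2 -ᶻ + a)   ≡⟨ cong (λ z → (-ᶻ q) *ᶻ + 2 +ᶻ (z -ᶻ + a)) e ⟨
    (-ᶻ q) *ᶻ + 2 +ᶻ (+ a -ᶻ + a)                     ≡⟨ lemma₂ ((-ᶻ q) *ᶻ + 2) (+ a) ⟩
    (-ᶻ q) *ᶻ + 2                                     ∎)
    where
    open ≡-Reasoning
    lemma₁ : ∀ a d q → d ≡ (-ᶻ q) *ᶻ + 2 +ᶻ (a +ᶻ d +ᶻ q *ᶻ + 2 -ᶻ a)
    lemma₁ = solve-∀
    lemma₂ : ∀ x a → x +ᶻ (a -ᶻ a) ≡ x
    lemma₂ = solve-∀

  cyclic-distinct : ∀ a b → a < b → b < n → ¬ position cyclic a ≋ position cyclic b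
  cyclic-distinct a b a<b b<n (differ-by q positions) with depth a (ℕP.<-trans a<b b<n) | depth b b<n
  ... | Da , Da<h , da , region-a | Db , Db<h , db , region-b
    with ModH.≋⇒≡ Da Db Da<h Db<h (ModH.differ-by (+ a -ᶻ + b -ᶻ q *ᶻ + 2)
           (depths-congruent (+ a) (+ b) (drift cyclic a) (drift cyclic b) (+ Da) (+ Db) q da db (in-halves {cyclic} {a} {b} {q} positions)))
  ... | refl with ℕP.m≤n⇒∃[o]m+o≡n (ℕP.<⇒≤ a<b)
  ...   | δ , refl with even-gap a δ q (indices-congruent (+ a) (+ (a + δ)) (drift cyclic a) q
                                          (trans (in-halves {cyclic} {a} {a + δ} {q} positions) (cong (λ p → H *ᶻ + (a + δ) +ᶻ p +ᶻ q *ᶻ (H +ᶻ H)) (sym same-drift))))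
    where
    same-drift : drift cyclic a ≡ drift cyclic (a + δ)
    same-drift = +ᶻ-cancelˡ (+ Da) _ _ (trans da (sym db))
  ...     | m , refl = same-depth-odd-gap a (a + m * 2) Da region-a region-b a<b m refl

  position-+n : ∀ {f} → Periodic n f → drift f n ≡ + 0 → ∀ k → position f (k + n) ≋ position f k
  position-+n {f} periodic balanced k = differ-by H (begin
    H *ᶻ + (k + n) +ᶻ drift f (k + n)              ≡⟨ cong₂ (λ a b → H *ᶻ a +ᶻ b) (ℤP.pos-+ k n) (drift-+period f periodic k) ⟩
    H *ᶻ (+ k +ᶻ + n) +ᶻ (drift f k +ᶻ drift f n)  ≡⟨ cong (λ z → H *ᶻ (+ k +ᶻ + n) +ᶻ (drift f k +ᶻ z)) balanced ⟩
    H *ᶻ (+ k +ᶻ + n) +ᶻ (drift f k +ᶻ + 0)        ≡⟨ lemma H (+ k) (+ n) (drift f k) ⟩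
    position f k +ᶻ H *ᶻ + n                       ∎)
    where
    open ≡-Reasoning
    lemma : ∀ H k n p → H *ᶻ (k +ᶻ n) +ᶻ (p +ᶻ + 0) ≡ H *ᶻ k +ᶻ p +ᶻ H *ᶻ n
    lemma = solve-∀

  reduce : ∀ k → position cyclic k ≋ position cyclic (k % n)
  reduce = periodic⇒≋% (position cyclic) (position-+n cyclic-periodic cyclic-balanced)

  cyclic-window-injective : WindowInjective cyclic
  cyclic-window-injective x y x<y y<x+n same with ℕP.<-cmp (x % n) (y % n)
  ... | tri< lt _ _ = cyclic-distinct (x % n) (y % n) lt (m%n<n y n) (≋-trans (≋-sym (reduce x)) (≋-trans same (reduce y)))
  ... | tri≈ _ eq _ = %-injective-on-window x y x<y y<x+n eq
  ... | tri> _ _ gt = cyclic-distinct (y % n) (x % n) gt (m%n<n x n) (≋-trans (≋-sym (reduce y)) (≋-trans (≋-sym same) (reduce x)))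

  shift-window-injective : ∀ f t → WindowInjective f → WindowInjective (λ i → f (i + t))
  shift-window-injective f t injective x y x<y y<x+n same =
    injective (x + t) (y + t) (ℕP.+-monoˡ-< t x<y) (subst (y + t <_) (lemma x n t) (ℕP.+-monoˡ-< t y<x+n))
      (≋-trans (≡⇒≋ (sym (shifted x))) (≋-trans (≋-+ same (≋-refl _)) (≡⇒≋ (shifted y))))
    where
    lemma : ∀ x n t → x + n + t ≡ x + t + n
    lemma = ℕSolver.solve-∀
    rearrange : ∀ H x t p q → H *ᶻ x +ᶻ p +ᶻ (H *ᶻ t +ᶻ q) ≡ H *ᶻ (x +ᶻ t) +ᶻ (p +ᶻ q)
    rearrange = solve-∀
    shifted : ∀ z → position (λ i → f (i + t)) z +ᶻ (H *ᶻ + t +ᶻ drift f t) ≡ position f (z + t)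
    shifted z = trans (rearrange H (+ z) (+ t) _ _) (cong₂ (λ a b → H *ᶻ a +ᶻ b) (sym (ℤP.pos-+ z t)) (drift-shift f t z))

  shift-drift-period : ∀ f t → Periodic n f → drift (λ i → f (i + t)) n ≡ drift f n
  shift-drift-period f t periodic = +ᶻ-cancelʳ (drift f t) _ _ (begin
    drift (λ i → f (i + t)) n +ᶻ drift f t  ≡⟨ drift-shift f t n ⟩
    drift f (n + t)                         ≡⟨ cong (drift f) (ℕP.+-comm n t) ⟩
    drift f (t + n)                         ≡⟨ drift-+period f periodic t ⟩
    drift f t +ᶻ drift f n                  ≡⟨ ℤP.+-comm (drift f t) (drift f n) ⟩
    drift f n +ᶻ drift f t                  ∎)
    where open ≡-Reasoning

  rotated : ℕ → Word
  rotated t k = cyclic (k + t)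

  rotated-admissible : ∀ t → Admissible (rotated t)
  rotated-admissible t =
      (λ k → trans (cong cyclic (lemma k n t)) (cyclic-periodic (k + t)))
    , shift-window-injective cyclic t cyclic-window-injective
    , ≡⇒≋ (trans (shift-drift-period cyclic t cyclic-periodic) cyclic-balanced)
    where
    lemma : ∀ k n t → k + n + t ≡ k + t + n
    lemma = ℕSolver.solve-∀

  constant-window-injective : ∀ s c → + len s *ᶻ + len s ≡ + 1 +ᶻ c *ᶻ + n → WindowInjective (λ _ → s)
  constant-window-injective s c square x y x<y y<x+n (differ-by q positions) with ℕP.m≤n⇒∃[o]m+o≡n (ℕP.<⇒≤ x<y)
  ... | δ , refl = ℕP.<-irrefl (sym (trans (cong (x ℕ.+_) δ≡0) (ℕP.+-identityʳ x))) x<y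
    where
    L : ℤ
    L = + len s
    at : ∀ k → position (λ _ → s) k ≡ + k *ᶻ L
    at k = trans (constant-position (λ _ → s) s k (λ _ _ → refl)) (ℤP.pos-* k (len s))
    xL≡ : + x *ᶻ L ≡ (+ x +ᶻ + δ) *ᶻ L +ᶻ q *ᶻ + n
    xL≡ = trans (sym (at x)) (trans positions (cong (λ z → z +ᶻ q *ᶻ + n) (trans (at (x + δ)) (cong (_*ᶻ L) (ℤP.pos-+ x δ)))))
    identity : ∀ x δ q L c n → (x *ᶻ L ≡ (x +ᶻ δ) *ᶻ L +ᶻ q *ᶻ n) → L *ᶻ L ≡ + 1 +ᶻ c *ᶻ n → δ ≡ + 0 +ᶻ (-ᶻ (q *ᶻ L) -ᶻ δ *ᶻ c) *ᶻ n
    identity x δ q L c n e sq = begin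
      δ                                                                ≡⟨ expand x δ q L c n ⟩
      T +ᶻ δ *ᶻ ((+ 1 +ᶻ c *ᶻ n) -ᶻ L *ᶻ L) -ᶻ L *ᶻ (x *ᶻ L -ᶻ R)      ≡⟨ cong₂ (λ u v → T +ᶻ δ *ᶻ ((+ 1 +ᶻ c *ᶻ n) -ᶻ u) -ᶻ L *ᶻ (v -ᶻ R)) sq e ⟩
      T +ᶻ δ *ᶻ ((+ 1 +ᶻ c *ᶻ n) -ᶻ (+ 1 +ᶻ c *ᶻ n)) -ᶻ L *ᶻ (R -ᶻ R)  ≡⟨ collapse T δ (+ 1 +ᶻ c *ᶻ n) L R ⟩
      T                                                                ∎
      where
      open ≡-Reasoning
      T R : ℤ
      T = + 0 +ᶻ (-ᶻ (q *ᶻ L) -ᶻ δ *ᶻ c) *ᶻ n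
      R = (x +ᶻ δ) *ᶻ L +ᶻ q *ᶻ n
      expand : ∀ x δ q L c n → δ ≡ + 0 +ᶻ (-ᶻ (q *ᶻ L) -ᶻ δ *ᶻ c) *ᶻ n +ᶻ δ *ᶻ ((+ 1 +ᶻ c *ᶻ n) -ᶻ L *ᶻ L)
                                   -ᶻ L *ᶻ (x *ᶻ L -ᶻ ((x +ᶻ δ) *ᶻ L +ᶻ q *ᶻ n))
      expand = solve-∀
      collapse : ∀ t δ a L r → t +ᶻ δ *ᶻ (a -ᶻ a) -ᶻ L *ᶻ (r -ᶻ r) ≡ t
      collapse = solve-∀
    δ≡0 : δ ≡ 0
    δ≡0 = ≋0⇒≡0 δ (ℕP.+-cancelˡ-< x δ n y<x+n) (differ-by (-ᶻ (q *ᶻ L) -ᶻ + δ *ᶻ c) (identity (+ x) (+ δ) q L c (+ n) xL≡ square))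

  -- For even h, (h ∓ 1)² ≡ 1 (mod n), so a constant short or long step permutes ℤₙ.
  module EvenHalf (m : ℕ) (h≡2m : h ≡ m * 2) where
    +h≡ : H ≡ + m *ᶻ + 2
    +h≡ = trans (cong +_ h≡2m) (ℤP.pos-* m 2)

    +n≡ : + n ≡ + m *ᶻ + 2 *ᶻ + 2
    +n≡ = trans (ℤP.pos-* h 2) (cong (_*ᶻ + 2) +h≡)

    square-short : + len short *ᶻ + len short ≡ + 1 +ᶻ (+ m -ᶻ + 1) *ᶻ + n
    square-short = begin
      + ℓ *ᶻ + ℓ                                  ≡⟨ cong (λ z → z *ᶻ z) (trans (pred-suc (+ ℓ)) (cong (_-ᶻ + 1) +h≡)) ⟩
      (+ m *ᶻ + 2 -ᶻ + 1) *ᶻ (+ m *ᶻ + 2 -ᶻ + 1)  ≡⟨ lemma (+ m) ⟩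
      + 1 +ᶻ (+ m -ᶻ + 1) *ᶻ (+ m *ᶻ + 2 *ᶻ + 2)  ≡⟨ cong (λ z → + 1 +ᶻ (+ m -ᶻ + 1) *ᶻ z) +n≡ ⟨
      + 1 +ᶻ (+ m -ᶻ + 1) *ᶻ + n                  ∎
      where
      open ≡-Reasoning
      pred-suc : ∀ x → x ≡ (+ 1 +ᶻ x) -ᶻ + 1
      pred-suc = solve-∀
      lemma : ∀ M → (M *ᶻ + 2 -ᶻ + 1) *ᶻ (M *ᶻ + 2 -ᶻ + 1) ≡ + 1 +ᶻ (M -ᶻ + 1) *ᶻ (M *ᶻ + 2 *ᶻ + 2)
      lemma = solve-∀

    square-long : + len long *ᶻ + len long ≡ + 1 +ᶻ (+ m +ᶻ + 1) *ᶻ + n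
    square-long = begin
      + suc h *ᶻ + suc h                          ≡⟨ cong (λ z → z *ᶻ z) (cong (+ 1 +ᶻ_) +h≡) ⟩
      (+ 1 +ᶻ + m *ᶻ + 2) *ᶻ (+ 1 +ᶻ + m *ᶻ + 2)  ≡⟨ lemma (+ m) ⟩
      + 1 +ᶻ (+ m +ᶻ + 1) *ᶻ (+ m *ᶻ + 2 *ᶻ + 2)  ≡⟨ cong (λ z → + 1 +ᶻ (+ m +ᶻ + 1) *ᶻ z) +n≡ ⟨
      + 1 +ᶻ (+ m +ᶻ + 1) *ᶻ + n                  ∎
      where
      open ≡-Reasoning
      lemma : ∀ M → (+ 1 +ᶻ M *ᶻ + 2) *ᶻ (+ 1 +ᶻ M *ᶻ + 2) ≡ + 1 +ᶻ (M +ᶻ + 1) *ᶻ (M *ᶻ + 2 *ᶻ + 2)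
      lemma = solve-∀

    constant-admissible : ∀ s c → + len s *ᶻ + len s ≡ + 1 +ᶻ c *ᶻ + n → drift (λ _ → s) n ≋ + 0 → Admissible (λ _ → s)
    constant-admissible s c square closes = (λ _ → refl) , constant-window-injective s c square , closes

    shorts-admissible : Admissible (λ _ → short)
    shorts-admissible = constant-admissible short (+ m -ᶻ + 1) square-short (≋-trans (≡⇒≋ shorts-drift) (≋-neg n≋0))
      where
      shorts-drift : drift (λ _ → short) n ≡ -ᶻ + n
      shorts-drift = trans (lemma (+ n) _) (cong (_-ᶻ + n) (sym (drift-short-run (λ _ → short) 0 n (λ _ _ → refl))))
        where
        lemma : ∀ a x → x ≡ (a +ᶻ x) -ᶻ a
        lemma = solve-∀

    longs-admissible : Admissible (λ _ → long)
    longs-admissible = constant-admissible long (+ m +ᶻ + 1) square-long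
      (≋-trans (≡⇒≋ (trans (drift-long-run (λ _ → long) 0 n (λ _ _ → refl)) (ℤP.+-identityʳ (+ n)))) n≋0)


  walk-injective-words : ∀ f f' → walk f ≗ walk f' → f ≗ f'
  walk-injective-words f f' same k = len-injective-mod (walk f k) (f k) (f' k)
    (trans (same (suc k)) (cong (λ z → (z + len (f' k)) % n) (sym (same k))))

  canonical-mid⁻¹ : ∀ j → canonical j ≡ mid → j ≡ 0 ⊎ j ≡ h
  canonical-mid⁻¹ zero    _ = inj₁ refl
  canonical-mid⁻¹ (suc j) e = by-position (ℕP.<-cmp j ℓ)
    where
    by-position : Tri (j < ℓ) (j ≡ ℓ) (ℓ < j) → suc j ≡ 0 ⊎ suc j ≡ h
    by-position (tri< j<ℓ _ _) = case trans (sym (canonical-short j j<ℓ)) e of λ ()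
    by-position (tri≈ _ j≡ℓ _) = inj₂ (cong suc j≡ℓ)
    by-position (tri> _ _ ℓ<j) = case trans (sym (canonical-long j ℓ<j)) e of λ ()

  module _ (t : ℕ) (t<n : t < n) where
    unwind : ℕ
    unwind = n ∸ t

    unwind+t : unwind + t ≡ n
    unwind+t = ℕP.m∸n+n≡m (ℕP.<⇒≤ t<n)

    rotated-mid : rotated t unwind ≡ mid
    rotated-mid = cong canonical (trans (cong (_% n) unwind+t) (n%n≡0 n))

    rotated-short : rotated t (suc unwind) ≡ short
    rotated-short = trans (cong canonical (trans (cong (λ z → suc z % n) unwind+t) ([m+n]%n≡m%n 1 n))) (canonical-short 0 (s≤s z≤n))

  rotated-injective : ∀ t t' → t < n → t' < n → rotated t ≗ rotated t' → t ≡ t'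
  rotated-injective t t' t<n t'<n same with canonical-mid⁻¹ ((unwind t t<n + t') % n) (trans (sym (same (unwind t t<n))) (rotated-mid t t<n))
  ... | inj₁ k+t'%n≡0 = sym (≋⇒≡ t' t t'<n t<n (≋-cancelʳ (+ k) (begin
    + t' +ᶻ + k  ≡⟨ trans (ℤP.+-comm (+ t') (+ k)) (sym (ℤP.pos-+ k t')) ⟩
    + (k + t')   ≈⟨ %≡⇒≋ _ _ (trans k+t'%n≡0 (sym (trans (cong (_% n) (unwind+t t t<n)) (n%n≡0 n)))) ⟩
    + (k + t)    ≡⟨ trans (ℤP.pos-+ k t) (ℤP.+-comm (+ k) (+ t)) ⟩
    + t +ᶻ + k   ∎)))
    where
    open ≋-Reasoning
    k : ℕ
    k = unwind t t<n
  ... | inj₂ k+t'%n≡h = case trans (sym (rotated-short t t<n)) (trans (same (suc (unwind t t<n))) long-next) of λ ()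
    where
    long-next : rotated t' (suc (unwind t t<n)) ≡ long
    long-next = trans (cong canonical (trans (suc-% (unwind t t<n + t')) (trans (cong (λ z → suc z % n) k+t'%n≡h) (m<n⇒m%n≡m 1+h<n))))
                      (canonical-long h (ℕP.n<1+n ℓ))
      where
      1+h<n : suc h < n
      1+h<n = subst (suc h <_) (sym n≡ℓ+1+h) (ℕP.m<n+m (suc h) {ℓ} (s≤s z≤n))

  rotated≢constant : ∀ t s → t < n → s ≢ mid → ¬ rotated t ≗ (λ _ → s)
  rotated≢constant t s t<n s≢mid same = s≢mid (trans (sym (same (unwind t t<n))) (rotated-mid t t<n))


  GoodRow : (ℕ → ℕ) → Set
  GoodRow R = Row R × Attains R

  admissible-good : ∀ {f} → Admissible f → GoodRow (walk f)
  admissible-good adm = RowOfWord.walk-row adm , RowOfWord.walk-attains adm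

  rotation-rows : List (ℕ → ℕ)
  rotation-rows = applyUpTo (λ t → walk (rotated t)) n

  rotation-rows-good : All GoodRow rotation-rows
  rotation-rows-good = All.applyUpTo⁺₁ _ n (λ {t} _ → admissible-good (rotated-admissible t))

  rotation-rows-distinct : AllPairs (λ R R' → ¬ R ≗ R') rotation-rows
  rotation-rows-distinct = AllPairs.applyUpTo⁺₁ _ n λ {i} {j} i<j j<n same →
    ℕP.<-irrefl (rotated-injective i j (ℕP.<-trans i<j j<n) j<n (walk-injective-words _ _ same)) i<j

  classify-row : ∀ R → Row R → Any (R ≗_) rotation-rows ⊎ (2 ∣ h × (R ≗ walk (λ _ → short) ⊎ R ≗ walk (λ _ → long)))
  classify-row R row = by-shape (Classification.classify periodic injective closes)
    where
    open WordOfRow row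
    periodic = proj₁ word-admissible
    injective = proj₁ (proj₂ word-admissible)
    closes = proj₂ (proj₂ word-admissible)
    R≗ : ∀ {f} → word ≗ f → R ≗ walk f
    R≗ same k = trans (sym (walk-word k)) (walk-cong same k)
    by-shape : Rotation word ⊎ (2 ∣ h × (∀ k → word k ≡ short)) ⊎ (2 ∣ h × (∀ k → word k ≡ long)) →
               Any (R ≗_) rotation-rows ⊎ (2 ∣ h × (R ≗ walk (λ _ → short) ⊎ R ≗ walk (λ _ → long)))
    by-shape (inj₁ (t , t<n , rot))          = inj₁ (Any.applyUpTo⁺ (λ t → walk (rotated t)) (R≗ rot) t<n)
    by-shape (inj₂ (inj₁ (even , shorts))) = inj₂ (even , inj₁ (R≗ shorts))
    by-shape (inj₂ (inj₂ (even , longs)))  = inj₂ (even , inj₂ (R≗ longs))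

  module _ (Good : Square n → Set)
           (count : ∀ rows → All GoodRow rows → AllPairs (λ R R' → ¬ R ≗ R') rows →
                    (∀ R → Row R → Any (R ≗_) rows) → HasExactly (Square n) Good (length rows)) where

    odd-census : ¬ 2 ∣ h → HasExactly (Square n) Good n
    odd-census odd = subst (HasExactly (Square n) Good) (length-applyUpTo (λ t → walk (rotated t)) n)
      (count rotation-rows rotation-rows-good rotation-rows-distinct complete)
      where
      complete : ∀ R → Row R → Any (R ≗_) rotation-rows
      complete R row = [ (λ listed → listed) , (λ found → ⊥-elim (odd (proj₁ found))) ]′ (classify-row R row)

    even-census : 2 ∣ h → HasExactly (Square n) Good (n + 2)
    even-census (divides m h≡2m) = subst (HasExactly (Square n) Good) (trans (cong (suc ∘ suc) (length-applyUpTo (λ t → walk (rotated t)) n)) (ℕP.+-comm 2 n))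
      (count rows good distinct complete)
      where
      open EvenHalf m h≡2m
      rows : List (ℕ → ℕ)
      rows = walk (λ _ → short) ∷ walk (λ _ → long) ∷ rotation-rows
      good : All GoodRow rows
      good = admissible-good shorts-admissible ∷ admissible-good longs-admissible ∷ rotation-rows-good
      not-rotated : ∀ s → s ≢ mid → All (λ R → ¬ walk (λ _ → s) ≗ R) rotation-rows
      not-rotated s s≢mid = All.applyUpTo⁺₁ _ n λ {t} t<n same →
        rotated≢constant t s t<n s≢mid (λ k → sym (walk-injective-words _ _ same k))
      distinct : AllPairs (λ R R' → ¬ R ≗ R') rows
      distinct = ((λ same → case walk-injective-words _ _ same 0 of λ ()) ∷ not-rotated short (λ ()))
               ∷ not-rotated long (λ ())
               ∷ rotation-rows-distinct
      complete : ∀ R → Row R → Any (R ≗_) rows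
      complete R row = [ (λ listed → there (there listed)) , (λ found → [ here , (λ R≗longs → there (here R≗longs)) ]′ (proj₂ found)) ]′
                         (classify-row R row)

  n%4≡0⇒even : n % 4 ≡ 0 → 2 ∣ h
  n%4≡0⇒even n%4≡0 with parity h
  ... | m , inj₁ h≡2m = divides m h≡2m
  ... | m , inj₂ h≡1+2m = case trans (sym n%4≡0) (trans (cong (λ x → (x * 2) % 4) h≡1+2m) (trans (cong (_% 4) (lemma m)) ([m+kn]%n≡m%n 2 m 4))) of λ ()
    where
    lemma : ∀ m → suc (m * 2) * 2 ≡ 2 + m * 4
    lemma = ℕSolver.solve-∀

  n%4≡2⇒odd : n % 4 ≡ 2 → ¬ 2 ∣ h
  n%4≡2⇒odd n%4≡2 (divides m h≡2m) =
    case trans (sym n%4≡2) (trans (cong (λ x → (x * 2) % 4) h≡2m) (trans (cong (_% 4) (lemma m)) ([m+kn]%n≡m%n 0 m 4))) of λ ()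
    where
    lemma : ∀ m → m * 2 * 2 ≡ 0 + m * 4
    lemma = ℕSolver.solve-∀

mainTheorem12 : (n : ℕ) → 6 ≤ n → 2 ∣ n →
    (n % 4 ≡ 0 → HasExactly (Square n) (GoodCirculant n) (n + 2) × HasExactly (Square n) (GoodBackCirculant n) (n + 2)) ×
    (n % 4 ≡ 2 → HasExactly (Square n) (GoodCirculant n) n × HasExactly (Square n) (GoodBackCirculant n) n)
mainTheorem12 .(0 * 2) () (divides 0 refl)
mainTheorem12 .(1 * 2) (s≤s (s≤s ())) (divides 1 refl)
mainTheorem12 .(2 * 2) (s≤s (s≤s (s≤s (s≤s ())))) (divides 2 refl)
mainTheorem12 .(suc (suc (suc g)) * 2) _ (divides (suc (suc (suc g))) refl) =
    (λ n%4≡0 → even-census _ CirculantCount.count (n%4≡0⇒even n%4≡0) , even-census _ BackCirculantCount.count (n%4≡0⇒even n%4≡0))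
  , (λ n%4≡2 → odd-census _ CirculantCount.count (n%4≡2⇒odd n%4≡2) , odd-census _ BackCirculantCount.count (n%4≡2⇒odd n%4≡2))
  where open EvenOrder g
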